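{- Let $\mathbf x=(x_1,\dots,x_m)$ and $\mathbf y=(y_1,\dots,y_n)$ be compositions and $d\ge\max(|\mathbf x|,|\mathbf y|)$ an integer. Let $(s,\ell)$ be a degenerate weighted shape on white vertices $\{1,\dots,m\}$ and black vertices $\{1,\dots,n\}$, with total weight $|\ell|=\sum_j\ell_j$. Then the number of weighted shapes $(s',\ell')$ of type $(\mathbf x^d,\mathbf y^d)$ with $(s',\ell')|_{[m],[n]}=(s,\ell)$ is $$\Bigl((d-|\mathbf y|)!\prod_{i=1}^m\frac{(x_i)_{x_i(s,\ell)}}{x_i!}\Bigr)\cdot\Bigl((d-|\mathbf x|)!\prod_{i=1}^n\frac{(y_i)_{y_i(s,\ell)}}{y_i!}\Bigr)\cdot\frac1{(d+|\ell|-|\mathbf x|-|\mathbf y|)!},$$ with the conventions $(a)_k=a(a-1)\cdots(a-k+1)$ (which is $0$ when $k>a$) and $1/N!=0$ for negative integers $N$. In particular this number is $0$ if $|\ell|>\min(|\mathbf x|,|\mathbf y|)$ or if $d-|\ell|>(d-|\mathbf x|)+(d-|\mathbf y|)$.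
   Context: Weighted shapes. - A weighted shape on white vertices $\{1,\dots,M\}$ and black vertices $\{1,\dots,N\}$ is a pair $(s,\ell)$, where $s$ is a bipartite forest on these vertices with no isolated vertex and $\ell=(\ell_1,\dots,\ell_{|s|})$ assigns a positive integer weight to each edge. - $x_i(s,\ell)$ (resp. $y_i(s,\ell)$) is the sum of the weights of edges at white (resp. black) vertex $i$, and equals $0$ for an isolated vertex. - The type of $(s,\ell)$ is $((x_i(s,\ell))_i,(y_i(s,\ell))_i)$. - A degenerate weighted shape is defined in the same way except that isolated vertices are allowed. Completions and restriction. - $\mathbf x^d=(x_1,\dots,x_m,1^{d-|\mathbf x|})$ is the completion by $d-|\mathbf x|$ ones; it has $m'=m+d-|\mathbf x|$ parts. Similarly $\mathbf y^d$ has $n'=n+d-|\mathbf y|$ parts. - In a weighted shape of type $(\mathbf x^d,\mathbf y^d)$, white vertices of index $>m$ and black vertices of index $>n$ have weight $1$, hence are leaves. - $(s',\ell')|_{[m],[n]}$ is the degenerate weighted shape obtained by deleting these vertices and their incident edges. -}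

module Defs where

open import Data.Nat using (ℕ; zero; suc; _+_; _*_; _∸_; _≤_; _<_; _⊓_; _!)

open import Data.Fin using (Fin; inject₁; fromℕ) renaming (zero to fzero; suc to fsuc)
open import Data.Vec using (Vec; lookup; map; take; _++_; replicate; foldr; sum)
open import Data.Product using (Σ; ∃; _×_)
open import Data.List using (List; length)
open import Data.List.Membership.Propositional using (_∈_)
open import Data.List.Relation.Unary.Unique.Propositional using (Unique)
open import Relation.Nullary using (¬_)
open import Relation.Binary.PropositionalEquality using (_≡_)
open import Function.Definitions using (Injective)
open import Function.Bundles using (_⇔_)

-- A weighted bipartite graph on white vertices Fin M and black vertices Fin N
-- is encoded by its weight matrix: entry i j = weight of the edge between
-- white i and black j, and 0 means "no edge". Since weights are positive
-- integers, (s , ℓ) corresponds exactly to such a matrix (edge set = support).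
Matrix : ℕ → ℕ → Set
Matrix M N = Vec (Vec ℕ N) M

entry : ∀ {M N} → Matrix M N → Fin M → Fin N → ℕ
entry w i j = lookup (lookup w i) j

Adj : ∀ {M N} → Matrix M N → Fin M → Fin N → Set
Adj w i j = 0 < entry w i j

-- A cycle in the bipartite graph: k = 2 + len ≥ 2 distinct white vertices
-- w₀ … w_{k-1} and k distinct black vertices b₀ … b_{k-1} with edges
-- w_j — b_j and b_j — w_{j+1} (indices mod k).
record Cycle {M N : ℕ} (w : Matrix M N) : Set where
  field
    len    : ℕ
    whites : Fin (suc (suc len)) → Fin M
    blacks : Fin (suc (suc len)) → Fin N
    whites-inj : Injective _≡_ _≡_ whites
    blacks-inj : Injective _≡_ _≡_ blacks
    edge-wb : ∀ j → Adj w (whites j) (blacks j)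
    edge-bw : ∀ (j : Fin (suc len)) → Adj w (whites (fsuc j)) (blacks (inject₁ j))
    edge-close : Adj w (whites fzero) (blacks (fromℕ (suc len)))

IsForest : ∀ {M N} → Matrix M N → Set
IsForest w = ¬ Cycle w

whiteWeight : ∀ {M N} → Matrix M N → Fin M → ℕ
whiteWeight w i = sum (lookup w i)

blackWeight : ∀ {M N} → Matrix M N → Fin N → ℕ
blackWeight w j = sum (map (λ r → lookup r j) w)

totalWeight : ∀ {M N} → Matrix M N → ℕ
totalWeight w = sum (map sum w)

NoIsolated : ∀ {M N} → Matrix M N → Set
NoIsolated {M} {N} w =
  (∀ (i : Fin M) → ∃ λ (j : Fin N) → Adj w i j) ×
  (∀ (j : Fin N) → ∃ λ (i : Fin M) → Adj w i j)

-- degenerate weighted shape (isolated vertices allowed)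
IsDegenerateWeightedShape : ∀ {M N} → Matrix M N → Set
IsDegenerateWeightedShape w = IsForest w

IsWeightedShape : ∀ {M N} → Matrix M N → Set
IsWeightedShape w = IsForest w × NoIsolated w

IsWeightedShapeOfType : ∀ {M N} → Vec ℕ M → Vec ℕ N → Matrix M N → Set
IsWeightedShapeOfType {M} {N} a b w =
  IsWeightedShape w ×
  (∀ (i : Fin M) → whiteWeight w i ≡ lookup a i) ×
  (∀ (j : Fin N) → blackWeight w j ≡ lookup b j)

IsComposition : ∀ {m} → Vec ℕ m → Set
IsComposition {m} x = ∀ (i : Fin m) → 1 ≤ lookup x i

complete : ∀ {m} (x : Vec ℕ m) (d : ℕ) → Vec ℕ (m + (d ∸ sum x))
complete x d = x ++ replicate (d ∸ sum x) 1

restrict : ∀ {m k n l} → Matrix (m + k) (n + l) → Matrix m n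
restrict {m} {k} {n} {l} w = map (take n) (take m w)

-- falling factorial (a)_k = a(a-1)⋯(a-k+1), which is 0 when k > a
falling : ℕ → ℕ → ℕ
falling a zero = 1
falling a (suc k) = falling a k * (a ∸ k)

prodV : ∀ {m} → Vec ℕ m → ℕ
prodV = foldr _ _*_ 1

-- number of elements of a predicate on a type: a duplicate-free list
-- containing exactly the elements satisfying the predicate has length c
HasCount : {A : Set} → (A → Set) → ℕ → Set
HasCount {A} P c = Σ (List A) λ L → Unique L × (∀ a → (a ∈ L) ⇔ P a) × length L ≡ c

module Submission where

-- A weighted shape of type (x^d, y^d) is a weight matrix w' (0 = no edge)
-- whose support is a forest without isolated vertices, with row sums
-- x ++ 1^a and column sums y ++ 1^b, where a = d - |x| and b = d - |y|.
-- The added vertices have weight 1, so they are leaves; a cycle never passes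
-- through a leaf, hence w' is a forest as soon as its restriction w is, and
-- the forest condition disappears.  What remains is to count matrices with
-- prescribed row and column sums whose top-left block is w: each white
-- vertex i of w receives its missing weight rᵢ = xᵢ - xᵢ(w) from distinct
-- black leaves (an rᵢ-subset of the b leaf columns), and each added white
-- leaf is a unit row.  Filling the rows one by one, the count c satisfies
--     c · ∏ rᵢ! · ∏ sⱼ! · (b - |r|)!  =  a! · b!        (s = y - colSums w),
-- by binomial coefficients for the rows of w and a multinomial coefficient
-- for the unit rows.  Finally xᵢ! = (xᵢ)_{xᵢ(w)} · rᵢ! and
-- d + |ℓ| - |x| - |y| = b - |r| turn this into the formula of the theorem.

open import Defs
open import Data.Nat using (ℕ; zero; suc; _+_; _*_; _∸_; _≤_; _<_; _⊓_; _!; z≤n; s≤s; s≤s⁻¹; _≤?_; _≟_)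
open import Data.Nat.Properties
open import Data.Nat.Combinatorics using (nCk≡n!/k![n-k]!; k![n∸k]!∣n!; nCk+nC[k+1]≡[n+1]C[k+1]) renaming (_C_ to _choose_)
open import Data.Nat.DivMod using (m/n*n≡m)
open import Data.Nat.Solver using (module +-*-Solver)
open import Data.Vec using (Vec; []; _∷_; _++_; replicate; sum; take; drop; lookup; map; tabulate; zipWith)
import Data.Vec.Properties as Vecₚ
open import Data.Vec.Relation.Binary.Pointwise.Inductive as Pointwise using (Pointwise; []; _∷_)
open import Data.Vec.Relation.Unary.All as VecAll using ([]; _∷_)
open import Data.List as List using (List; []; _∷_; length)
import Data.Nat.ListAction as ListAction
open import Data.List.Properties using (length-++; length-map)
open import Data.List.Membership.Propositional using (_∈_; _∉_)
open import Data.List.Membership.Propositional.Properties using (∈-map⁺; ∈-map⁻; ∈-++⁺ˡ; ∈-++⁺ʳ; ∈-++⁻)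
open import Data.List.Relation.Unary.Any using (here; there)
open import Data.List.Relation.Unary.All as ListAll using ([]; _∷_)
open import Data.List.Relation.Unary.AllPairs using ([]; _∷_)
open import Data.List.Relation.Unary.Unique.Propositional using (Unique)
import Data.List.Relation.Unary.Unique.Propositional.Properties as Uniqueₚ
open import Data.Fin using (Fin; _↑ˡ_; _↑ʳ_; splitAt; toℕ; inject₁; fromℕ) renaming (zero to fzero; suc to fsuc)
import Data.Fin.Properties as Finₚ
open import Data.Product using (Σ; _×_; _,_; proj₁; proj₂)
open import Data.Sum using (_⊎_; inj₁; inj₂)
open import Data.Empty using (⊥-elim)
open import Data.Unit using (⊤; tt)
open import Relation.Nullary using (¬_; Dec; yes; no)
open import Relation.Binary.PropositionalEquality
open import Function.Bundles using (_⇔_; mk⇔; Equivalence)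
open Equivalence using (to; from)

HasCount-⇔ : {A : Set} {P Q : A → Set} {c : ℕ} → (∀ a → P a ⇔ Q a) → HasCount P c → HasCount Q c
HasCount-⇔ P⇔Q (L , unique , mem , len) =
  L , unique , (λ a → mk⇔ (λ a∈L → to (P⇔Q a) (to (mem a) a∈L)) (λ qa → from (mem a) (from (P⇔Q a) qa))) , len

HasCount-empty : {A : Set} {P : A → Set} → (∀ a → ¬ P a) → HasCount P 0
HasCount-empty ¬P = [] , [] , (λ a → mk⇔ (λ ()) (λ pa → ⊥-elim (¬P a pa))) , refl

HasCount-image : {A B : Set} {P : A → Set} {Q : B → Set} {c : ℕ} (f : A → B) →
  (∀ {a a'} → f a ≡ f a' → a ≡ a') →
  (∀ a → P a → Q (f a)) → (∀ b → Q b → Σ A λ a → P a × f a ≡ b) →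
  HasCount P c → HasCount Q c
HasCount-image {P = P} {Q} f f-inj P⇒Q Q⇒P (L , unique , mem , len) =
  List.map f L , Uniqueₚ.map⁺ f-inj unique , (λ b → mk⇔ (image⇒Q b) (Q⇒image b)) ,
  trans (length-map f L) len
  where
  image⇒Q : ∀ b → b ∈ List.map f L → Q b
  image⇒Q b b∈ with ∈-map⁻ f b∈
  ... | a , a∈L , refl = P⇒Q a (to (mem a) a∈L)
  Q⇒image : ∀ b → Q b → b ∈ List.map f L
  Q⇒image b qb with Q⇒P b qb
  ... | a , pa , refl = ∈-map⁺ f (from (mem a) pa)

module _ {A : Set} {K : ℕ} (Tail : A → Vec A K → Set) (cf : A → ℕ)
         (tailCount : ∀ v → HasCount (Tail v) (cf v)) where

  private
    notIn : ∀ {v₀ : A} {xs : List A} → ListAll.All (v₀ ≢_) xs → v₀ ∉ xs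
    notIn (v₀≢x ∷ _) (here eq) = v₀≢x eq
    notIn (_ ∷ rest) (there v₀∈) = notIn rest v₀∈

  consList : (Lh : List A) → Unique Lh →
    Σ (List (Vec A (suc K))) λ L → Unique L ×
      (∀ v M → (v ∷ M) ∈ L ⇔ (v ∈ Lh × Tail v M)) × length L ≡ ListAction.sum (List.map cf Lh)
  consList [] _ = [] , [] , (λ v M → mk⇔ (λ ()) (λ { (() , _) })) , refl
  consList (v₀ ∷ Lh) (v₀∉Lh ∷ unique) with consList Lh unique | tailCount v₀
  ... | L , uniqueL , memL , lenL | L₀ , unique₀ , mem₀ , len₀ =
    List.map (v₀ ∷_) L₀ List.++ L ,
    Uniqueₚ.++⁺ (Uniqueₚ.map⁺ (λ { refl → refl }) unique₀) uniqueL disjoint ,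
    (λ v M → mk⇔ (forward v M) (backward v M)) ,
    trans (length-++ (List.map (v₀ ∷_) L₀)) (cong₂ _+_ (trans (length-map _ L₀) len₀) lenL)
    where
    disjoint : ∀ {z} → ¬ (z ∈ List.map (v₀ ∷_) L₀ × z ∈ L)
    disjoint (z∈₀ , z∈L) with ∈-map⁻ (v₀ ∷_) z∈₀
    ... | M , _ , refl = notIn v₀∉Lh (proj₁ (to (memL v₀ M) z∈L))
    forward : ∀ v M → (v ∷ M) ∈ List.map (v₀ ∷_) L₀ List.++ L → v ∈ v₀ ∷ Lh × Tail v M
    forward v M v∷M∈ with ∈-++⁻ (List.map (v₀ ∷_) L₀) v∷M∈
    ... | inj₁ ∈₀ with ∈-map⁻ (v₀ ∷_) ∈₀
    ... | M' , M'∈ , refl = here refl , to (mem₀ M') M'∈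
    forward v M v∷M∈ | inj₂ ∈L with to (memL v M) ∈L
    ... | v∈Lh , tail = there v∈Lh , tail
    backward : ∀ v M → v ∈ v₀ ∷ Lh × Tail v M → (v ∷ M) ∈ List.map (v₀ ∷_) L₀ List.++ L
    backward v M (here refl , tail) = ∈-++⁺ˡ (∈-map⁺ (v₀ ∷_) (from (mem₀ M) tail))
    backward v M (there v∈Lh , tail) = ∈-++⁺ʳ (List.map (v₀ ∷_) L₀) (from (memL v M) (v∈Lh , tail))

  HasCount-cons : (Vecs : Vec A (suc K) → Set) (Head : A → Set) →
    (∀ v M → Vecs (v ∷ M) ⇔ (Head v × Tail v M)) →
    (Lh : List A) → Unique Lh → (∀ v → v ∈ Lh ⇔ Head v) →
    HasCount Vecs (ListAction.sum (List.map cf Lh))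
  HasCount-cons Vecs Head split Lh uniqueLh memLh with consList Lh uniqueLh
  ... | L , uniqueL , memL , lenL =
    L , uniqueL ,
    (λ { (v ∷ M) → mk⇔
          (λ ∈L → let v∈Lh , tail = to (memL v M) ∈L in from (split v M) (to (memLh v) v∈Lh , tail))
          (λ vec → let head , tail = to (split v M) vec in from (memL v M) (from (memLh v) head , tail)) }) ,
    lenL

ifYes : {X : Set} → Dec X → ℕ → ℕ
ifYes (yes _) c = c
ifYes (no _) c = 0

HasCount-guard : {A X : Set} {Y : A → Set} {c : ℕ} (X? : Dec X) → HasCount Y c →
  HasCount (λ a → X × Y a) (ifYes X? c)
HasCount-guard (yes x) count = HasCount-⇔ (λ a → mk⇔ (x ,_) proj₂) count
HasCount-guard (no ¬x) count = HasCount-empty (λ a xy → ¬x (proj₁ xy))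

module _ {A : Set} where

  sum-*-termwise : (L : List A) (f g : A → ℕ) (D F : ℕ) → (∀ v → v ∈ L → f v * D ≡ g v * F) →
    ListAction.sum (List.map f L) * D ≡ ListAction.sum (List.map g L) * F
  sum-*-termwise [] f g D F termwise = refl
  sum-*-termwise (v ∷ L) f g D F termwise = begin
      (f v + ListAction.sum (List.map f L)) * D        ≡⟨ *-distribʳ-+ D (f v) _ ⟩
      f v * D + ListAction.sum (List.map f L) * D      ≡⟨ cong₂ _+_ (termwise v (here refl))
                                                           (sum-*-termwise L f g D F (λ u u∈ → termwise u (there u∈))) ⟩
      g v * F + ListAction.sum (List.map g L) * F      ≡⟨ *-distribʳ-+ F (g v) _ ⟨
      (g v + ListAction.sum (List.map g L)) * F        ∎
    where open ≡-Reasoning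

  sum-const : (L : List A) (f : A → ℕ) (D F : ℕ) → (∀ v → v ∈ L → f v * D ≡ F) →
    ListAction.sum (List.map f L) * D ≡ length L * F
  sum-const L f D F termwise =
    trans (sum-*-termwise L f (λ _ → 1) D F (λ v v∈ → trans (termwise v v∈) (sym (+-identityʳ F))))
          (cong (_* F) (count-ones L))
    where
    count-ones : (L : List A) → ListAction.sum (List.map (λ _ → 1) L) ≡ length L
    count-ones [] = refl
    count-ones (v ∷ L) = cong suc (count-ones L)

  sum-zero : (L : List A) (f : A → ℕ) → (∀ v → v ∈ L → f v ≡ 0) → ListAction.sum (List.map f L) ≡ 0
  sum-zero [] f vanish = refl
  sum-zero (v ∷ L) f vanish = cong₂ _+_ (vanish v (here refl)) (sum-zero L f (λ u u∈ → vanish u (there u∈)))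

δ : ℕ → ℕ → ℕ
δ zero zero = 1
δ zero (suc _) = 0
δ (suc _) zero = 0
δ (suc m) (suc n) = δ m n

δ-refl : ∀ m → δ m m ≡ 1
δ-refl zero = refl
δ-refl (suc m) = δ-refl m

δ-≢ : ∀ m n → m ≢ n → δ m n ≡ 0
δ-≢ zero zero m≢n = ⊥-elim (m≢n refl)
δ-≢ zero (suc n) _ = refl
δ-≢ (suc m) zero _ = refl
δ-≢ (suc m) (suc n) m≢n = δ-≢ m n (λ e → m≢n (cong suc e))

-- l choose r = l! / (r! (l-r)!) as an identity without division.
choose-factorials : ∀ l r → r ≤ l → (l choose r) * (r ! * (l ∸ r) !) ≡ l !
choose-factorials l r r≤l = trans (cong (_* (r ! * (l ∸ r) !)) (nCk≡n!/k![n-k]! r≤l))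
                             (m/n*n≡m {{r !* (l ∸ r) !≢0}} (k![n∸k]!∣n! r≤l))

falling-> : ∀ a k → a < k → falling a k ≡ 0
falling-> a (suc k) a<1+k with m≤n⇒m<n∨m≡n (s≤s⁻¹ a<1+k)
... | inj₁ a<k = cong (_* (a ∸ k)) (falling-> a k a<k)
... | inj₂ refl = trans (cong (falling a a *_) (n∸n≡0 a)) (*-zeroʳ (falling a a))

falling-factorial : ∀ a k → k ≤ a → a ! ≡ falling a k * (a ∸ k) !
falling-factorial a zero _ = sym (+-identityʳ _)
falling-factorial a (suc k) k<a = begin
    a !                                               ≡⟨ falling-factorial a k (≤-trans (n≤1+n k) k<a) ⟩
    falling a k * (a ∸ k) !                           ≡⟨ cong (λ z → falling a k * z !) a∸k≡1+ ⟩
    falling a k * (suc (a ∸ suc k)) !                 ≡⟨ *-assoc (falling a k) (suc (a ∸ suc k)) _ ⟨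
    falling a k * suc (a ∸ suc k) * (a ∸ suc k) !     ≡⟨ cong (λ z → falling a k * z * (a ∸ suc k) !) a∸k≡1+ ⟨
    falling a k * (a ∸ k) * (a ∸ suc k) !             ∎
  where
  open ≡-Reasoning
  a∸k≡1+ : a ∸ k ≡ suc (a ∸ suc k)
  a∸k≡1+ = +-∸-assoc 1 k<a

-- Pointwise arithmetic on vectors of naturals.  A vector κ of "capacities"
-- is consumed row by row while a matrix is filled in.

infix 4 _≤v_
_≤v_ : ∀ {C} → Vec ℕ C → Vec ℕ C → Set
_≤v_ = Pointwise _≤_

_≤v?_ : ∀ {C} (u v : Vec ℕ C) → Dec (u ≤v v)
_≤v?_ = Pointwise.decidable _≤?_

infixl 6 _+v_ _∸v_
_+v_ _∸v_ : ∀ {C} → Vec ℕ C → Vec ℕ C → Vec ℕ C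
_+v_ = zipWith _+_
_∸v_ = zipWith _∸_

zeros : ∀ C → Vec ℕ C
zeros C = replicate C 0

colSums : ∀ {K C} → Matrix K C → Vec ℕ C
colSums [] = zeros _
colSums (v ∷ M) = v +v colSums M

rowSums : ∀ {K C} → Matrix K C → Vec ℕ K
rowSums = map sum

prod! : ∀ {C} → Vec ℕ C → ℕ
prod! v = prodV (map _! v)

ZeroOne : ∀ {C} → Vec ℕ C → Set
ZeroOne = VecAll.All (_≤ 1)

zeros≤v : ∀ {C} (v : Vec ℕ C) → zeros C ≤v v
zeros≤v [] = []
zeros≤v (x ∷ v) = z≤n ∷ zeros≤v v

∸v-zeros : ∀ {C} (v : Vec ℕ C) → v ∸v zeros C ≡ v
∸v-zeros [] = refl
∸v-zeros (x ∷ v) = cong (x ∷_) (∸v-zeros v)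

sum-zeros : ∀ C → sum (zeros C) ≡ 0
sum-zeros zero = refl
sum-zeros (suc C) = sum-zeros C

sum≡0⇒zeros : ∀ {C} (v : Vec ℕ C) → sum v ≡ 0 → v ≡ zeros C
sum≡0⇒zeros [] _ = refl
sum≡0⇒zeros (zero ∷ v) e = cong (0 ∷_) (sum≡0⇒zeros v e)

+v≡⇔ : ∀ {C} (v u κ : Vec ℕ C) → (v +v u ≡ κ) ⇔ (v ≤v κ × u ≡ κ ∸v v)
+v≡⇔ v u κ = mk⇔ (forward v u κ) (backward v u κ)
  where
  forward : ∀ {C} (v u κ : Vec ℕ C) → v +v u ≡ κ → v ≤v κ × u ≡ κ ∸v v
  forward [] [] [] _ = [] , refl
  forward (x ∷ v) (y ∷ u) (k ∷ κ) eq with forward v u κ (Vecₚ.∷-injectiveʳ eq) | Vecₚ.∷-injectiveˡ eq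
  ... | v≤κ , u≡ | refl = m≤m+n x y ∷ v≤κ , cong₂ _∷_ (sym (m+n∸m≡n x y)) u≡
  backward : ∀ {C} (v u κ : Vec ℕ C) → v ≤v κ × u ≡ κ ∸v v → v +v u ≡ κ
  backward [] [] [] _ = refl
  backward (x ∷ v) (y ∷ u) (k ∷ κ) (x≤k ∷ v≤κ , eq) =
    cong₂ _∷_ (trans (cong (x +_) (Vecₚ.∷-injectiveˡ eq)) (m+[n∸m]≡n x≤k))
              (backward v u κ (v≤κ , Vecₚ.∷-injectiveʳ eq))

+v≤⇔ : ∀ {C} (v u κ : Vec ℕ C) → (v +v u) ≤v κ ⇔ (v ≤v κ × u ≤v (κ ∸v v))
+v≤⇔ v u κ = mk⇔ (forward v u κ) (backward v u κ)
  where
  forward : ∀ {C} (v u κ : Vec ℕ C) → (v +v u) ≤v κ → (v ≤v κ × u ≤v (κ ∸v v))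
  forward [] [] [] _ = [] , []
  forward (x ∷ v) (y ∷ u) (k ∷ κ) (x+y≤k ∷ rest) with forward v u κ rest
  ... | v≤κ , u≤κ∸v = ≤-trans (m≤m+n x y) x+y≤k ∷ v≤κ ,
                      subst (_≤ k ∸ x) (m+n∸m≡n x y) (∸-monoˡ-≤ x x+y≤k) ∷ u≤κ∸v
  backward : ∀ {C} (v u κ : Vec ℕ C) → (v ≤v κ × u ≤v (κ ∸v v)) → (v +v u) ≤v κ
  backward [] [] [] _ = []
  backward (x ∷ v) (y ∷ u) (k ∷ κ) (x≤k ∷ v≤κ , y≤k∸x ∷ u≤κ∸v) =
    subst (x + y ≤_) (m+[n∸m]≡n x≤k) (+-monoʳ-≤ x y≤k∸x) ∷ backward v u κ (v≤κ , u≤κ∸v)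

∸v-+v : ∀ {C} (κ v u : Vec ℕ C) → κ ∸v (v +v u) ≡ (κ ∸v v) ∸v u
∸v-+v [] [] [] = refl
∸v-+v (k ∷ κ) (x ∷ v) (y ∷ u) = cong₂ _∷_ (sym (∸-+-assoc k x y)) (∸v-+v κ v u)

∸v-++ : ∀ {n b} (κA : Vec ℕ n) (κB : Vec ℕ b) (v : Vec ℕ (n + b)) →
  (κA ++ κB) ∸v v ≡ (κA ∸v take n v) ++ (κB ∸v drop n v)
∸v-++ [] κB v = refl
∸v-++ (k ∷ κA) κB (x ∷ v) = cong ((k ∸ x) ∷_) (∸v-++ κA κB v)

≤v-++⇔ : ∀ {n b} (κA : Vec ℕ n) (κB : Vec ℕ b) (v : Vec ℕ (n + b)) →
  v ≤v (κA ++ κB) ⇔ (take n v ≤v κA × drop n v ≤v κB)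
≤v-++⇔ κA κB v = mk⇔ (forward κA κB v) (backward κA κB v)
  where
  forward : ∀ {n b} (κA : Vec ℕ n) (κB : Vec ℕ b) (v : Vec ℕ (n + b)) →
    v ≤v (κA ++ κB) → (take n v ≤v κA × drop n v ≤v κB)
  forward [] κB v v≤ = [] , v≤
  forward (k ∷ κA) κB (x ∷ v) (x≤k ∷ v≤) with forward κA κB v v≤
  ... | take≤ , drop≤ = x≤k ∷ take≤ , drop≤
  backward : ∀ {n b} (κA : Vec ℕ n) (κB : Vec ℕ b) (v : Vec ℕ (n + b)) →
    (take n v ≤v κA × drop n v ≤v κB) → v ≤v (κA ++ κB)
  backward [] κB v (_ , drop≤) = drop≤
  backward (k ∷ κA) κB (x ∷ v) (x≤k ∷ take≤ , drop≤) = x≤k ∷ backward κA κB v (take≤ , drop≤)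

take-++ : ∀ {n b} (w : Vec ℕ n) (u : Vec ℕ b) → take n (w ++ u) ≡ w
take-++ [] u = refl
take-++ (x ∷ w) u = cong (x ∷_) (take-++ w u)

drop-++ : ∀ {n b} (w : Vec ℕ n) (u : Vec ℕ b) → drop n (w ++ u) ≡ u
drop-++ [] u = refl
drop-++ (x ∷ w) u = drop-++ w u

sum-∸v+ : ∀ {C} (κ v : Vec ℕ C) → v ≤v κ → sum (κ ∸v v) + sum v ≡ sum κ
sum-∸v+ [] [] _ = refl
sum-∸v+ (k ∷ κ) (x ∷ v) (x≤k ∷ v≤κ) = begin
    (k ∸ x + sum (κ ∸v v)) + (x + sum v)   ≡⟨ +-assoc (k ∸ x) _ _ ⟩
    k ∸ x + (sum (κ ∸v v) + (x + sum v))   ≡⟨ cong (k ∸ x +_) (x+[y+z]≡y+[x+z] (sum (κ ∸v v)) x (sum v)) ⟩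
    k ∸ x + (x + (sum (κ ∸v v) + sum v))   ≡⟨ +-assoc (k ∸ x) x _ ⟨
    (k ∸ x + x) + (sum (κ ∸v v) + sum v)   ≡⟨ cong₂ _+_ (m∸n+n≡m x≤k) (sum-∸v+ κ v v≤κ) ⟩
    k + sum κ                              ∎
  where
  open ≡-Reasoning
  x+[y+z]≡y+[x+z] : ∀ a b c → a + (b + c) ≡ b + (a + c)
  x+[y+z]≡y+[x+z] a b c = trans (sym (+-assoc a b c)) (trans (cong (_+ c) (+-comm a b)) (+-assoc b a c))

sum-∸v : ∀ {C} (κ v : Vec ℕ C) → v ≤v κ → sum (κ ∸v v) ≡ sum κ ∸ sum v
sum-∸v κ v v≤κ = trans (sym (m+n∸n≡m _ (sum v))) (cong (_∸ sum v) (sum-∸v+ κ v v≤κ))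

sum-+v : ∀ {C} (v u : Vec ℕ C) → sum (v +v u) ≡ sum v + sum u
sum-+v [] [] = refl
sum-+v (x ∷ v) (y ∷ u) = trans (cong (x + y +_) (sum-+v v u)) (+-interchange x y (sum v) (sum u))
  where
  +-interchange : ∀ a b c d → a + b + (c + d) ≡ a + c + (b + d)
  +-interchange a b c d = solve 4 (λ a b c d → a :+ b :+ (c :+ d) := a :+ c :+ (b :+ d)) refl a b c d
    where open +-*-Solver

≤v⇒sum≤ : ∀ {C} (v κ : Vec ℕ C) → v ≤v κ → sum v ≤ sum κ
≤v⇒sum≤ [] [] _ = z≤n
≤v⇒sum≤ (x ∷ v) (k ∷ κ) (x≤k ∷ v≤κ) = +-mono-≤ x≤k (≤v⇒sum≤ v κ v≤κ)

sum-take+drop : ∀ n {b} (v : Vec ℕ (n + b)) → sum v ≡ sum (take n v) + sum (drop n v)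
sum-take+drop zero v = refl
sum-take+drop (suc n) (x ∷ v) = trans (cong (x +_) (sum-take+drop n v)) (sym (+-assoc x _ _))

sum-colSums : ∀ {K C} (w : Matrix K C) → sum (colSums w) ≡ sum (rowSums w)
sum-colSums {C = C} [] = sum-zeros C
sum-colSums (v ∷ w) = trans (sum-+v v (colSums w)) (cong (sum v +_) (sum-colSums w))

ZeroOne-∸v : ∀ {C} (κ v : Vec ℕ C) → ZeroOne κ → ZeroOne (κ ∸v v)
ZeroOne-∸v [] [] _ = []
ZeroOne-∸v (k ∷ κ) (x ∷ v) (k≤1 ∷ κ01) = ≤-trans (m∸n≤m k x) k≤1 ∷ ZeroOne-∸v κ v κ01

replicate-ZeroOne : ∀ C {k} → k ≤ 1 → ZeroOne (replicate C k)
replicate-ZeroOne zero k≤1 = []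
replicate-ZeroOne (suc C) k≤1 = k≤1 ∷ replicate-ZeroOne C k≤1

prod!-ZeroOne : ∀ {C} (κ : Vec ℕ C) → ZeroOne κ → prod! κ ≡ 1
prod!-ZeroOne [] _ = refl
prod!-ZeroOne (.0 ∷ κ) (z≤n ∷ κ01) = trans (+-identityʳ _) (prod!-ZeroOne κ κ01)
prod!-ZeroOne (.1 ∷ κ) (s≤s z≤n ∷ κ01) = trans (+-identityʳ _) (prod!-ZeroOne κ κ01)

prod!-++ : ∀ {n b} (u : Vec ℕ n) (v : Vec ℕ b) → prod! (u ++ v) ≡ prod! u * prod! v
prod!-++ [] v = sym (+-identityʳ _)
prod!-++ (x ∷ u) v = trans (cong (x ! *_) (prod!-++ u v)) (sym (*-assoc (x !) _ _))

-- Fill Hs κ M says that the rows of M satisfy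
-- the row conditions Hs and that they use up the column capacities κ exactly;
-- each row is required to fit in what is left, so that counting fillings can
-- proceed by choosing the first row and recursing on the remaining capacities.

Fill : ∀ {K C} → Vec (Vec ℕ C → Set) K → Vec ℕ C → Matrix K C → Set
Fill [] κ [] = κ ≡ zeros _
Fill (H ∷ Hs) κ (v ∷ M) = H v × v ≤v κ × Fill Hs (κ ∸v v) M

AllRows : ∀ {K C} → Vec (Vec ℕ C → Set) K → Matrix K C → Set
AllRows [] [] = ⊤
AllRows (H ∷ Hs) (v ∷ M) = H v × AllRows Hs M

Fill⇔ : ∀ {K C} (Hs : Vec (Vec ℕ C → Set) K) (κ : Vec ℕ C) (M : Matrix K C) →
  Fill Hs κ M ⇔ (AllRows Hs M × colSums M ≡ κ)
Fill⇔ Hs κ M = mk⇔ (forward Hs κ M) (backward Hs κ M)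
  where
  forward : ∀ {K C} (Hs : Vec (Vec ℕ C → Set) K) (κ : Vec ℕ C) (M : Matrix K C) →
    Fill Hs κ M → AllRows Hs M × colSums M ≡ κ
  forward [] κ [] eq = tt , sym eq
  forward (H ∷ Hs) κ (v ∷ M) (hv , v≤κ , rest) with forward Hs (κ ∸v v) M rest
  ... | rows , cols = (hv , rows) , from (+v≡⇔ v (colSums M) κ) (v≤κ , cols)
  backward : ∀ {K C} (Hs : Vec (Vec ℕ C → Set) K) (κ : Vec ℕ C) (M : Matrix K C) →
    AllRows Hs M × colSums M ≡ κ → Fill Hs κ M
  backward [] κ [] (_ , eq) = sym eq
  backward (H ∷ Hs) κ (v ∷ M) ((hv , rows) , cols) with to (+v≡⇔ v (colSums M) κ) cols
  ... | v≤κ , rest = hv , v≤κ , backward Hs (κ ∸v v) M (rows , rest)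

IsUnit : ∀ {C} → Vec ℕ C → Set
IsUnit v = sum v ≡ 1

units : ∀ C → List (Vec ℕ C)
units zero = []
units (suc C) = (1 ∷ zeros C) ∷ List.map (0 ∷_) (units C)

units-unique : ∀ C → Unique (units C)
units-unique zero = []
units-unique (suc C) = head∉tail (units C) ∷ Uniqueₚ.map⁺ (λ { refl → refl }) (units-unique C)
  where
  head∉tail : (L : List (Vec ℕ C)) → ListAll.All ((1 ∷ zeros C) ≢_) (List.map (0 ∷_) L)
  head∉tail [] = []
  head∉tail (u ∷ L) = (λ ()) ∷ head∉tail L

units-complete : ∀ {C} (v : Vec ℕ C) → v ∈ units C ⇔ IsUnit v
units-complete v = mk⇔ (listed⇒unit v) (unit⇒listed v)
  where
  listed⇒unit : ∀ {C} (v : Vec ℕ C) → v ∈ units C → IsUnit v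
  listed⇒unit {suc C} v (here refl) = cong suc (sum-zeros C)
  listed⇒unit {suc C} v (there v∈) with ∈-map⁻ (0 ∷_) v∈
  ... | u , u∈ , refl = listed⇒unit u u∈
  unit⇒listed : ∀ {C} (v : Vec ℕ C) → IsUnit v → v ∈ units C
  unit⇒listed (zero ∷ v) e = there (∈-map⁺ (0 ∷_) (unit⇒listed v e))
  unit⇒listed (suc zero ∷ v) e = here (cong (1 ∷_) (sum≡0⇒zeros v (suc-injective e)))

-- dot κ eⱼ = κⱼ picks the capacity of column j
dot : ∀ {C} → Vec ℕ C → Vec ℕ C → ℕ
dot [] [] = 0
dot (k ∷ κ) (x ∷ v) = x * k + dot κ v

dot-zeros : ∀ {C} (κ : Vec ℕ C) → dot κ (zeros C) ≡ 0
dot-zeros [] = refl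
dot-zeros (k ∷ κ) = dot-zeros κ

sum-dot-units : ∀ {C} (κ : Vec ℕ C) → ListAction.sum (List.map (dot κ) (units C)) ≡ sum κ
sum-dot-units [] = refl
sum-dot-units {suc C} (k ∷ κ) =
  cong₂ _+_ (trans (cong₂ _+_ (+-identityʳ k) (dot-zeros κ)) (+-identityʳ k))
            (trans (cong ListAction.sum (shift (units C))) (sum-dot-units κ))
  where
  shift : (L : List (Vec ℕ C)) → List.map (dot (k ∷ κ)) (List.map (0 ∷_) L) ≡ List.map (dot κ) L
  shift [] = refl
  shift (u ∷ L) = cong (dot κ u ∷_) (shift L)

prod!-unit : ∀ {C} (κ v : Vec ℕ C) → IsUnit v → v ≤v κ → prod! κ ≡ dot κ v * prod! (κ ∸v v)
prod!-unit (k ∷ κ) (zero ∷ v) e (_ ∷ v≤κ) = begin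
    k ! * prod! κ                         ≡⟨ cong (k ! *_) (prod!-unit κ v e v≤κ) ⟩
    k ! * (dot κ v * prod! (κ ∸v v))      ≡⟨ *-assoc (k !) (dot κ v) _ ⟨
    k ! * dot κ v * prod! (κ ∸v v)        ≡⟨ cong (_* prod! (κ ∸v v)) (*-comm (k !) (dot κ v)) ⟩
    dot κ v * k ! * prod! (κ ∸v v)        ≡⟨ *-assoc (dot κ v) (k !) _ ⟩
    dot κ v * (k ! * prod! (κ ∸v v))      ∎
  where open ≡-Reasoning
prod!-unit {suc C} (suc k ∷ κ) (suc zero ∷ v) e (_ ∷ _) with sum≡0⇒zeros v (suc-injective e)
... | refl = begin
    suc k ! * prod! κ                                      ≡⟨ *-assoc (suc k) (k !) _ ⟩
    suc k * (k ! * prod! κ)                                ≡⟨ cong₂ (λ a b → a * (k ! * b)) k+1≡dot (cong prod! (sym (∸v-zeros κ))) ⟩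
    dot (suc k ∷ κ) (1 ∷ zeros C) * (k ! * prod! (κ ∸v zeros C)) ∎
  where
  open ≡-Reasoning
  k+1≡dot : suc k ≡ suc k + 0 + dot κ (zeros C)
  k+1≡dot = sym (trans (cong (suc k + 0 +_) (dot-zeros κ)) (trans (+-identityʳ _) (+-identityʳ _)))

dot-unit-≰ : ∀ {C} (κ v : Vec ℕ C) → IsUnit v → ¬ v ≤v κ → dot κ v ≡ 0
dot-unit-≰ (k ∷ κ) (zero ∷ v) e v≰κ = dot-unit-≰ κ v e (λ v≤κ → v≰κ (z≤n ∷ v≤κ))
dot-unit-≰ (zero ∷ κ) (suc zero ∷ v) e v≰κ with sum≡0⇒zeros v (suc-injective e)
... | refl = dot-zeros κ
dot-unit-≰ (suc k ∷ κ) (suc zero ∷ v) e v≰κ with sum≡0⇒zeros v (suc-injective e)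
... | refl = ⊥-elim (v≰κ (s≤s z≤n ∷ zeros≤v κ))

unitRowsCount : ∀ {C} a (κ : Vec ℕ C) →
  Σ ℕ λ c → HasCount (Fill (replicate a IsUnit) κ) c × c * prod! κ ≡ a ! * δ (sum κ) a
unitRowsCount {C} zero κ with Vecₚ.≡-dec _≟_ κ (zeros C)
... | yes refl = 1 , onlyEmpty , (begin
      1 * prod! (zeros C)     ≡⟨ *-identityˡ _ ⟩
      prod! (zeros C)         ≡⟨ prod!-ZeroOne (zeros C) (replicate-ZeroOne C z≤n) ⟩
      1                       ≡⟨ cong (λ s → δ s 0) (sum-zeros C) ⟨
      δ (sum (zeros C)) 0     ≡⟨ *-identityˡ _ ⟨
      1 * δ (sum (zeros C)) 0 ∎)
  where
  open ≡-Reasoning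
  onlyEmpty : HasCount (Fill [] (zeros C)) 1
  onlyEmpty = ([] ∷ []) , ([] ∷ []) , (λ { [] → mk⇔ (λ _ → refl) (λ _ → here refl) }) , refl
... | no κ≢0 = 0 , HasCount-empty (λ { [] κ≡0 → κ≢0 κ≡0 }) ,
               sym (trans (+-identityʳ _) (δ-≢ (sum κ) 0 (λ s≡0 → κ≢0 (sum≡0⇒zeros κ s≡0))))
unitRowsCount {C} (suc a) κ = ListAction.sum (List.map cf (units C)) , count , identity
  where
  rest : Vec ℕ C → ℕ
  rest v = proj₁ (unitRowsCount a (κ ∸v v))
  cf : Vec ℕ C → ℕ
  cf v = ifYes (v ≤v? κ) (rest v)
  count : HasCount (Fill (replicate (suc a) IsUnit) κ) (ListAction.sum (List.map cf (units C)))
  count = HasCount-cons (λ v M → v ≤v κ × Fill (replicate a IsUnit) (κ ∸v v) M) cf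
            (λ v → HasCount-guard (v ≤v? κ) (proj₁ (proj₂ (unitRowsCount a (κ ∸v v)))))
            _ IsUnit (λ v M → mk⇔ (λ r → r) (λ r → r)) (units C) (units-unique C) units-complete
  F : ℕ
  F = a ! * δ (sum κ) (suc a)
  termwise : ∀ v → v ∈ units C → cf v * prod! κ ≡ dot κ v * F
  termwise v v∈ with v ≤v? κ | to (units-complete v) v∈
  ... | yes v≤κ | unit = begin
      rest v * prod! κ                                ≡⟨ cong (rest v *_) (prod!-unit κ v unit v≤κ) ⟩
      rest v * (dot κ v * prod! (κ ∸v v))             ≡⟨ x*[y*z]≡y*[x*z] (rest v) (dot κ v) _ ⟩
      dot κ v * (rest v * prod! (κ ∸v v))             ≡⟨ cong (dot κ v *_) (proj₂ (proj₂ (unitRowsCount a (κ ∸v v)))) ⟩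
      dot κ v * (a ! * δ (sum (κ ∸v v)) a)            ≡⟨ cong (λ s → dot κ v * (a ! * s)) δ-shift ⟩
      dot κ v * F                                     ∎
    where
    open ≡-Reasoning
    x*[y*z]≡y*[x*z] : ∀ x y z → x * (y * z) ≡ y * (x * z)
    x*[y*z]≡y*[x*z] x y z = trans (sym (*-assoc x y z)) (trans (cong (_* z) (*-comm x y)) (*-assoc y x z))
    δ-shift : δ (sum (κ ∸v v)) a ≡ δ (sum κ) (suc a)
    δ-shift = cong (λ s → δ s (suc a)) (trans (trans (+-comm 1 _) (cong (sum (κ ∸v v) +_) (sym unit))) (sum-∸v+ κ v v≤κ))
  ... | no v≰κ | unit = sym (cong (_* F) (dot-unit-≰ κ v unit v≰κ))
  identity : ListAction.sum (List.map cf (units C)) * prod! κ ≡ suc a ! * δ (sum κ) (suc a)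
  identity = trans (sum-*-termwise (units C) cf (dot κ) (prod! κ) F termwise)
                   (trans (cong (_* F) (sum-dot-units κ)) δ-absorbs)
    where
    δ-absorbs : sum κ * (a ! * δ (sum κ) (suc a)) ≡ suc a ! * δ (sum κ) (suc a)
    δ-absorbs with sum κ ≟ suc a
    ... | yes s≡ rewrite s≡ = sym (*-assoc (suc a) (a !) _)
    ... | no s≢ rewrite δ-≢ (sum κ) (suc a) s≢ =
      trans (cong (sum κ *_) (*-zeroʳ (a !))) (trans (*-zeroʳ (sum κ)) (sym (*-zeroʳ (suc a !))))

-- Subsets: for a 0/1 capacity vector κ, the vectors u ≤ κ with |u| = r are the
-- r-subsets of the |κ| available columns, so there are (|κ| choose r) of them.

module SubsetStep {b} (κ : Vec ℕ b)
  (IH : ∀ r → HasCount (λ u → u ≤v κ × sum u ≡ r) (sum κ choose r)) where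

  tailCount : ℕ → ℕ → ℕ
  tailCount zero r = sum κ choose r
  tailCount (suc e) zero = 0
  tailCount (suc e) (suc r) = tailCount e r

  tailCount-correct : ∀ e r → HasCount (λ u → u ≤v κ × e + sum u ≡ r) (tailCount e r)
  tailCount-correct zero r = IH r
  tailCount-correct (suc e) zero = HasCount-empty (λ _ ())
  tailCount-correct (suc e) (suc r) =
    HasCount-⇔ (λ u → mk⇔ (λ (u≤κ , s) → u≤κ , cong suc s) (λ (u≤κ , s) → u≤κ , suc-injective s))
               (tailCount-correct e r)

  consColumn : ∀ k r (heads : List ℕ) → Unique heads → (∀ e → e ∈ heads ⇔ e ≤ k) →
    HasCount (λ u → u ≤v (k ∷ κ) × sum u ≡ r) (ListAction.sum (List.map (λ e → tailCount e r) heads))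
  consColumn k r heads unique complete =
    HasCount-cons (λ e u → u ≤v κ × e + sum u ≡ r) (λ e → tailCount e r) (λ e → tailCount-correct e r)
      _ (_≤ k)
      (λ e u → mk⇔ (λ { (e≤k ∷ u≤κ , s) → e≤k , u≤κ , s }) (λ { (e≤k , u≤κ , s) → e≤k ∷ u≤κ , s }))
      heads unique complete

subsetCount : ∀ {b} (κ : Vec ℕ b) → ZeroOne κ → ∀ r →
  HasCount (λ u → u ≤v κ × sum u ≡ r) (sum κ choose r)
subsetCount [] _ zero =
  ([] ∷ []) , ([] ∷ []) , (λ { [] → mk⇔ (λ _ → [] , refl) (λ _ → here refl) }) , refl
subsetCount [] _ (suc r) = HasCount-empty (λ { [] (_ , ()) })
subsetCount (.0 ∷ κ) (z≤n ∷ κ01) r =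
  subst (HasCount _) (+-identityʳ _)
    (consColumn 0 r (0 ∷ []) ([] ∷ []) (λ e → mk⇔ (λ { (here refl) → z≤n }) (λ { z≤n → here refl })))
  where open SubsetStep κ (subsetCount κ κ01)
subsetCount (.1 ∷ κ) (s≤s z≤n ∷ κ01) r =
  subst (HasCount _) (pascal r)
    (consColumn 1 r (0 ∷ 1 ∷ []) (((λ ()) ∷ []) ∷ [] ∷ [])
      (λ e → mk⇔ (λ { (here refl) → z≤n ; (there (here refl)) → s≤s z≤n })
                 (λ { z≤n → here refl ; (s≤s z≤n) → there (here refl) })))
  where
  open SubsetStep κ (subsetCount κ κ01)
  pascal : ∀ r → tailCount 0 r + (tailCount 1 r + 0) ≡ suc (sum κ) choose r
  pascal zero = refl
  pascal (suc r) = trans (cong (sum κ choose suc r +_) (+-identityʳ _))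
                         (trans (+-comm (sum κ choose suc r) _) (nCk+nC[k+1]≡[n+1]C[k+1] (sum κ) r))

-- The white vertices of the given shape become
-- rows whose first n entries are prescribed (the row wᵢ of w) and whose total
-- is xᵢ; the missing weight rᵢ = xᵢ - |wᵢ| must be put on the leaf columns,
-- whose capacities are 0/1.  Below them come a rows that are unit vectors.

Prescribed : ∀ {n b} → Vec ℕ n → ℕ → Vec ℕ (n + b) → Set
Prescribed {n} wi xi v = take n v ≡ wi × sum v ≡ xi

prescribedRows : ∀ {m n b} → Matrix m n → Vec ℕ m → Vec (Vec ℕ (n + b) → Set) m
prescribedRows [] [] = []
prescribedRows (wi ∷ ws) (xi ∷ xs) = Prescribed wi xi ∷ prescribedRows ws xs

residual : ∀ {m n} → Matrix m n → Vec ℕ m → Vec ℕ m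
residual ws xs = xs ∸v rowSums ws

Feasible : ∀ {m n b} → Matrix m n → Vec ℕ m → Vec ℕ n → Vec ℕ b → Set
Feasible ws xs κA κB = colSums ws ≤v κA × sum (residual ws xs) ≤ sum κB

-- The completion count c satisfies c · denominator = numerator, where
--   denominator = ∏ rᵢ! · ∏ Kⱼ! · (l - |r|)!   and   numerator = a! · l! · [|K| + l - |r| = a],
-- with K = κA - colSums ws the remaining capacities of the given columns and
-- l = |κB| the number of leaf columns.
denominator : ∀ {m n} → Vec ℕ m → Vec ℕ n → ℕ → ℕ
denominator r K l = prod! r * prod! K * (l ∸ sum r) !

numerator : ∀ {m n} → ℕ → Vec ℕ m → Vec ℕ n → ℕ → ℕ
numerator a r K l = a ! * l ! * δ (sum K + (l ∸ sum r)) a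

CompletionCount : ∀ a {m n b} → Matrix m n → Vec ℕ m → Vec ℕ n → Vec ℕ b → ℕ → Set
CompletionCount a {n = n} {b} ws xs κA κB c =
  HasCount (Fill (prescribedRows {b = b} ws xs ++ replicate a IsUnit) (κA ++ κB)) c
  × (Feasible ws xs κA κB →
       c * denominator (residual ws xs) (κA ∸v colSums ws) (sum κB)
         ≡ numerator a (residual ws xs) (κA ∸v colSums ws) (sum κB))
  × (¬ Feasible ws xs κA κB → c ≡ 0)

completionCount-[] : ∀ a {n b} (κA : Vec ℕ n) (κB : Vec ℕ b) → ZeroOne κB →
  Σ ℕ (CompletionCount a [] [] κA κB)
completionCount-[] a {n} κA κB κB01 with unitRowsCount a (κA ++ κB)
... | c , count , identity = c , count , (λ _ → formula) , (λ infeasible → ⊥-elim (infeasible (zeros≤v κA , z≤n)))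
  where
  open ≡-Reasoning
  open +-*-Solver
  l : ℕ
  l = sum κB
  formula : c * (1 * prod! (κA ∸v zeros n) * (l ∸ 0) !) ≡ a ! * l ! * δ (sum (κA ∸v zeros n) + (l ∸ 0)) a
  formula rewrite ∸v-zeros κA = begin
      c * (1 * prod! κA * l !)                  ≡⟨ solve 3 (λ c p L → c :* (con 1 :* p :* L) := c :* (p :* con 1) :* L) refl c (prod! κA) (l !) ⟩
      c * (prod! κA * 1) * l !                  ≡⟨ cong (λ z → c * (prod! κA * z) * l !) (prod!-ZeroOne κB κB01) ⟨
      c * (prod! κA * prod! κB) * l !           ≡⟨ cong (λ z → c * z * l !) (prod!-++ κA κB) ⟨
      c * prod! (κA ++ κB) * l !                ≡⟨ cong (_* l !) identity ⟩
      a ! * δ (sum (κA ++ κB)) a * l !          ≡⟨ cong (λ z → a ! * δ z a * l !) (Vecₚ.sum-++ κA) ⟩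
      a ! * δ (sum κA + l) a * l !              ≡⟨ solve 3 (λ A d L → A :* d :* L := A :* L :* d) refl (a !) (δ (sum κA + l) a) (l !) ⟩
      a ! * l ! * δ (sum κA + l) a              ∎

FirstRow : ∀ {n b} → Vec ℕ n → ℕ → Vec ℕ n → Vec ℕ b → Vec ℕ (n + b) → Set
FirstRow wi xi κA κB v = Prescribed wi xi v × v ≤v (κA ++ κB)

leafPart-sum : ∀ {n b} {wi : Vec ℕ n} {xi} (v : Vec ℕ (n + b)) → Prescribed wi xi v →
  sum (drop n v) ≡ xi ∸ sum wi
leafPart-sum {n} {wi = wi} {xi} v (take≡ , sum≡) = begin
    sum (drop n v)                          ≡⟨ m+n∸m≡n (sum wi) _ ⟨
    sum wi + sum (drop n v) ∸ sum wi        ≡⟨ cong (λ z → sum z + sum (drop n v) ∸ sum wi) take≡ ⟨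
    sum (take n v) + sum (drop n v) ∸ sum wi ≡⟨ cong (_∸ sum wi) (sum-take+drop n v) ⟨
    sum v ∸ sum wi                          ≡⟨ cong (_∸ sum wi) sum≡ ⟩
    xi ∸ sum wi                             ∎
  where open ≡-Reasoning

leafCapacity-after : ∀ {n b} {wi : Vec ℕ n} {xi} (κA : Vec ℕ n) (κB : Vec ℕ b) (v : Vec ℕ (n + b)) →
  FirstRow wi xi κA κB v → sum (κB ∸v drop n v) ≡ sum κB ∸ (xi ∸ sum wi)
leafCapacity-after {n} κA κB v (prescribed , v≤κ) =
  trans (sum-∸v κB (drop n v) (proj₂ (to (≤v-++⇔ κA κB v) v≤κ))) (cong (sum κB ∸_) (leafPart-sum v prescribed))

-- When wᵢ fits, the first rows are wᵢ followed by an rᵢ-subset of the leaf columns.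
firstRowCount : ∀ {n b} (wi : Vec ℕ n) (xi : ℕ) (κA : Vec ℕ n) (κB : Vec ℕ b) →
  ZeroOne κB → sum wi ≤ xi → wi ≤v κA →
  HasCount (FirstRow wi xi κA κB) (sum κB choose (xi ∸ sum wi))
firstRowCount {n} {b} wi xi κA κB κB01 |wi|≤xi wi≤κA =
  HasCount-image (wi ++_) (Vecₚ.++-injectiveʳ wi wi) subset⇒row row⇒subset (subsetCount κB κB01 (xi ∸ sum wi))
  where
  subset⇒row : ∀ u → u ≤v κB × sum u ≡ xi ∸ sum wi → FirstRow wi xi κA κB (wi ++ u)
  subset⇒row u (u≤κB , |u|≡) =
    (take-++ wi u , trans (Vecₚ.sum-++ wi) (trans (cong (sum wi +_) |u|≡) (m+[n∸m]≡n |wi|≤xi))) ,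
    from (≤v-++⇔ κA κB (wi ++ u)) (subst (_≤v κA) (sym (take-++ wi u)) wi≤κA , subst (_≤v κB) (sym (drop-++ wi u)) u≤κB)
  row⇒subset : ∀ v → FirstRow wi xi κA κB v → Σ (Vec ℕ b) λ u → (u ≤v κB × sum u ≡ xi ∸ sum wi) × wi ++ u ≡ v
  row⇒subset v (prescribed@(take≡ , _) , v≤κ) =
    drop n v , (proj₂ (to (≤v-++⇔ κA κB v) v≤κ) , leafPart-sum v prescribed) ,
    trans (cong (_++ drop n v) (sym take≡)) (Vecₚ.take++drop≡id n v)

firstRow-misfit : ∀ {n b} {wi : Vec ℕ n} {xi} (κA : Vec ℕ n) (κB : Vec ℕ b) → ¬ wi ≤v κA →
  ∀ v → ¬ FirstRow wi xi κA κB v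
firstRow-misfit κA κB wi≰κA v ((take≡ , _) , v≤κ) = wi≰κA (subst (_≤v κA) take≡ (proj₁ (to (≤v-++⇔ κA κB v) v≤κ)))

Feasible-after : ∀ {m n b} (wi : Vec ℕ n) xi (ws : Matrix m n) (xs : Vec ℕ m)
  (κA : Vec ℕ n) (κB : Vec ℕ b) (v : Vec ℕ (n + b)) → FirstRow wi xi κA κB v →
  Feasible (wi ∷ ws) (xi ∷ xs) κA κB ⇔ Feasible ws xs (κA ∸v take n v) (κB ∸v drop n v)
Feasible-after {n = n} wi xi ws xs κA κB v first@((take≡ , _) , v≤κ) = mk⇔ forward backward
  where
  ri : ℕ
  ri = xi ∸ sum wi
  R : ℕ
  R = sum (residual ws xs)
  l : ℕ
  l = sum κB
  leafCap : sum (κB ∸v drop n v) ≡ l ∸ ri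
  leafCap = leafCapacity-after κA κB v first
  wi≤κA : wi ≤v κA
  wi≤κA = subst (_≤v κA) take≡ (proj₁ (to (≤v-++⇔ κA κB v) v≤κ))
  ri≤l : ri ≤ l
  ri≤l = subst (_≤ l) (leafPart-sum v (proj₁ first)) (≤v⇒sum≤ _ κB (proj₂ (to (≤v-++⇔ κA κB v) v≤κ)))
  forward : Feasible (wi ∷ ws) (xi ∷ xs) κA κB → Feasible ws xs (κA ∸v take n v) (κB ∸v drop n v)
  forward (cols≤ , ri+R≤l) =
    subst (λ z → colSums ws ≤v κA ∸v z) (sym take≡) (proj₂ (to (+v≤⇔ wi (colSums ws) κA) cols≤)) ,
    subst (R ≤_) (sym leafCap) (m+n≤o⇒m≤o∸n R (subst (_≤ l) (+-comm ri R) ri+R≤l))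
  backward : Feasible ws xs (κA ∸v take n v) (κB ∸v drop n v) → Feasible (wi ∷ ws) (xi ∷ xs) κA κB
  backward (cols≤ , R≤) =
    from (+v≤⇔ wi (colSums ws) κA) (wi≤κA , subst (λ z → colSums ws ≤v κA ∸v z) take≡ cols≤) ,
    subst (ri + R ≤_) (m+[n∸m]≡n ri≤l) (+-monoʳ-≤ ri (subst (R ≤_) leafCap R≤))

-- The arithmetic of one step: if c · D₀ = (l choose rᵢ) · E₀ for the problem
-- left after the first row (l - rᵢ leaf columns), then c · D = E for the whole
-- problem, because (l choose rᵢ) · rᵢ! · (l - rᵢ)! = l!.
step-identity : ∀ a {m n} ri (r : Vec ℕ m) (K : Vec ℕ n) l c → ri ≤ l →
  c * denominator r K (l ∸ ri) ≡ (l choose ri) * numerator a r K (l ∸ ri) →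
  c * denominator (ri ∷ r) K l ≡ numerator a (ri ∷ r) K l
step-identity a ri r K l c ri≤l previous = begin
    c * (ri ! * P * Q * (l ∸ (ri + sum r)) !)       ≡⟨ cong (λ z → c * (ri ! * P * Q * z !)) (∸-+-assoc l ri (sum r)) ⟨
    c * (ri ! * P * Q * F)                          ≡⟨ solve 5 (λ c R P Q F → c :* (R :* P :* Q :* F) := R :* (c :* (P :* Q :* F))) refl c (ri !) P Q F ⟩
    ri ! * (c * (P * Q * F))                        ≡⟨ cong (ri ! *_) previous ⟩
    ri ! * (Ch * (a ! * L' * d'))                   ≡⟨ solve 5 (λ R C A L d → R :* (C :* (A :* L :* d)) := A :* (C :* (R :* L)) :* d) refl (ri !) Ch (a !) L' d' ⟩
    a ! * (Ch * (ri ! * L')) * d'                   ≡⟨ cong (λ z → a ! * z * d') (choose-factorials l ri ri≤l) ⟩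
    a ! * l ! * d'                                  ≡⟨ cong (λ z → a ! * l ! * δ (sum K + z) a) (∸-+-assoc l ri (sum r)) ⟩
    a ! * l ! * δ (sum K + (l ∸ (ri + sum r))) a    ∎
  where
  open ≡-Reasoning
  open +-*-Solver
  P : ℕ
  P = prod! r
  Q : ℕ
  Q = prod! K
  F : ℕ
  F = (l ∸ ri ∸ sum r) !
  Ch : ℕ
  Ch = l choose ri
  L' : ℕ
  L' = (l ∸ ri) !
  d' : ℕ
  d' = δ (sum K + (l ∸ ri ∸ sum r)) a

completionStep : ∀ a {m n b} (wi : Vec ℕ n) xi (ws : Matrix m n) (xs : Vec ℕ m) (κA : Vec ℕ n) (κB : Vec ℕ b) →
  ZeroOne κB → sum wi ≤ xi →
  (∀ κA' (κB' : Vec ℕ b) → ZeroOne κB' → Σ ℕ (CompletionCount a ws xs κA' κB')) →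
  Σ ℕ (CompletionCount a (wi ∷ ws) (xi ∷ xs) κA κB)
completionStep a {m} {n} {b} wi xi ws xs κA κB κB01 |wi|≤xi remaining with wi ≤v? κA
... | no wi≰κA = 0 , HasCount-empty noFilling ,
                 (λ feasible → ⊥-elim (wi≰κA (proj₁ (to (+v≤⇔ wi (colSums ws) κA) (proj₁ feasible))))) ,
                 (λ _ → refl)
  where
  noFilling : ∀ M → ¬ Fill (prescribedRows (wi ∷ ws) (xi ∷ xs) ++ replicate a IsUnit) (κA ++ κB) M
  noFilling (v ∷ M) (prescribed , v≤κ , _) = firstRow-misfit κA κB wi≰κA v (prescribed , v≤κ)
... | yes wi≤κA = c , count , formula , vanish
  where
  Hs : Vec (Vec ℕ (n + b) → Set) (m + a)
  Hs = prescribedRows ws xs ++ replicate a IsUnit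
  rest : ∀ v → Σ ℕ (CompletionCount a ws xs (κA ∸v take n v) (κB ∸v drop n v))
  rest v = remaining (κA ∸v take n v) (κB ∸v drop n v) (ZeroOne-∸v κB (drop n v) κB01)
  cf : Vec ℕ (n + b) → ℕ
  cf v = proj₁ (rest v)
  firstRows : HasCount (FirstRow wi xi κA κB) (sum κB choose (xi ∸ sum wi))
  firstRows = firstRowCount wi xi κA κB κB01 |wi|≤xi wi≤κA
  Lh : List (Vec ℕ (n + b))
  Lh = proj₁ firstRows
  first∈ : ∀ v → v ∈ Lh → FirstRow wi xi κA κB v
  first∈ v v∈ = to (proj₁ (proj₂ (proj₂ firstRows)) v) v∈
  c : ℕ
  c = ListAction.sum (List.map cf Lh)
  count : HasCount (Fill (prescribedRows (wi ∷ ws) (xi ∷ xs) ++ replicate a IsUnit) (κA ++ κB)) c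
  count = HasCount-cons (λ v M → Fill Hs ((κA ++ κB) ∸v v) M) cf tailCount _ (FirstRow wi xi κA κB)
            (λ v M → mk⇔ (λ (p , v≤κ , f) → (p , v≤κ) , f) (λ ((p , v≤κ) , f) → p , v≤κ , f))
            Lh (proj₁ (proj₂ firstRows)) (proj₁ (proj₂ (proj₂ firstRows)))
    where
    tailCount : ∀ v → HasCount (Fill Hs ((κA ++ κB) ∸v v)) (cf v)
    tailCount v = subst (λ κ → HasCount (Fill Hs κ) (cf v)) (sym (∸v-++ κA κB v)) (proj₁ (proj₂ (rest v)))
  ri : ℕ
  ri = xi ∸ sum wi
  l : ℕ
  l = sum κB
  r : Vec ℕ m
  r = residual ws xs
  K₀ : Vec ℕ n
  K₀ = (κA ∸v wi) ∸v colSums ws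
  termwise : Feasible (wi ∷ ws) (xi ∷ xs) κA κB → ∀ v → v ∈ Lh →
    cf v * denominator r K₀ (l ∸ ri) ≡ numerator a r K₀ (l ∸ ri)
  termwise feasible v v∈ =
    subst₂ (λ A L → cf v * denominator r (A ∸v colSums ws) L ≡ numerator a r (A ∸v colSums ws) L)
           (cong (κA ∸v_) (proj₁ (proj₁ first))) (leafCapacity-after κA κB v first)
           (proj₁ (proj₂ (proj₂ (rest v))) (to (Feasible-after wi xi ws xs κA κB v first) feasible))
    where first = first∈ v v∈
  formula : Feasible (wi ∷ ws) (xi ∷ xs) κA κB →
    c * denominator (residual (wi ∷ ws) (xi ∷ xs)) (κA ∸v colSums (wi ∷ ws)) l
      ≡ numerator a (residual (wi ∷ ws) (xi ∷ xs)) (κA ∸v colSums (wi ∷ ws)) l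
  formula feasible rewrite ∸v-+v κA wi (colSums ws) =
    step-identity a ri r K₀ l c (m+n≤o⇒m≤o ri (proj₂ feasible))
      (trans (sum-const Lh cf _ _ (termwise feasible)) (cong (_* numerator a r K₀ (l ∸ ri)) (proj₂ (proj₂ (proj₂ firstRows)))))
  vanish : ¬ Feasible (wi ∷ ws) (xi ∷ xs) κA κB → c ≡ 0
  vanish infeasible = sum-zero Lh cf λ v v∈ →
    proj₂ (proj₂ (proj₂ (rest v))) (λ feasible' → infeasible (from (Feasible-after wi xi ws xs κA κB v (first∈ v v∈)) feasible'))

completionCount : ∀ a {m n b} (ws : Matrix m n) (xs : Vec ℕ m) (κA : Vec ℕ n) (κB : Vec ℕ b) →
  ZeroOne κB → rowSums ws ≤v xs → Σ ℕ (CompletionCount a ws xs κA κB)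
completionCount a [] [] κA κB κB01 [] = completionCount-[] a κA κB κB01
completionCount a (wi ∷ ws) (xi ∷ xs) κA κB κB01 (|wi|≤xi ∷ rows≤) =
  completionStep a wi xi ws xs κA κB κB01 |wi|≤xi
    (λ κA' κB' κB'01 → completionCount a ws xs κA' κB' κB'01 rows≤)

-- Cycles only pass through vertices of weight at least 2.  Hence a cycle of a
-- completed matrix avoids the added leaves and is a cycle of the given shape.

lookup≤sum : ∀ {C} (v : Vec ℕ C) j → lookup v j ≤ sum v
lookup≤sum (x ∷ v) fzero = m≤m+n x (sum v)
lookup≤sum (x ∷ v) (fsuc j) = m≤n⇒m≤o+n x (lookup≤sum v j)

twoPositive⇒2≤sum : ∀ {C} (v : Vec ℕ C) i j → i ≢ j → 0 < lookup v i → 0 < lookup v j → 2 ≤ sum v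
twoPositive⇒2≤sum (x ∷ v) fzero fzero i≢j _ _ = ⊥-elim (i≢j refl)
twoPositive⇒2≤sum (x ∷ v) fzero (fsuc j) _ x>0 vj>0 = +-mono-≤ x>0 (≤-trans vj>0 (lookup≤sum v j))
twoPositive⇒2≤sum (x ∷ v) (fsuc i) fzero _ vi>0 x>0 =
  subst (2 ≤_) (+-comm (sum v) x) (+-mono-≤ (≤-trans vi>0 (lookup≤sum v i)) x>0)
twoPositive⇒2≤sum (x ∷ v) (fsuc i) (fsuc j) i≢j vi>0 vj>0 =
  m≤n⇒m≤o+n x (twoPositive⇒2≤sum v i j (λ e → i≢j (cong fsuc e)) vi>0 vj>0)

column : ∀ {M N} → Matrix M N → Fin N → Vec ℕ M
column w c = map (λ row → lookup row c) w

lookup-column : ∀ {M N} (w : Matrix M N) c i → lookup (column w c) i ≡ entry w i c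
lookup-column w c i = Vecₚ.lookup-map i (λ row → lookup row c) w

last-or-inject₁ : ∀ k (j : Fin (suc k)) → j ≡ fromℕ k ⊎ Σ (Fin k) λ j' → j ≡ inject₁ j'
last-or-inject₁ zero fzero = inj₁ refl
last-or-inject₁ (suc k) fzero = inj₂ (fzero , refl)
last-or-inject₁ (suc k) (fsuc j) with last-or-inject₁ k j
... | inj₁ e = inj₁ (cong fsuc e)
... | inj₂ (j' , e) = inj₂ (fsuc j' , cong fsuc e)

fsuc≢inject₁ : ∀ {k} (j : Fin k) → fsuc j ≢ inject₁ j
fsuc≢inject₁ j e = 1+n≢n (trans (cong toℕ e) (Finₚ.toℕ-inject₁ j))

module _ {M N} {w : Matrix M N} (cyc : Cycle w) where
  open Cycle cyc

  cycle-whiteWeight : ∀ j → 2 ≤ whiteWeight w (whites j)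
  cycle-whiteWeight fzero =
    twoPositive⇒2≤sum (lookup w (whites fzero)) (blacks fzero) (blacks (fromℕ (suc len)))
      (λ e → 0≢last (blacks-inj e)) (edge-wb fzero) edge-close
    where
    0≢last : fzero ≢ fromℕ (suc len)
    0≢last ()
  cycle-whiteWeight (fsuc j) =
    twoPositive⇒2≤sum (lookup w (whites (fsuc j))) (blacks (fsuc j)) (blacks (inject₁ j))
      (λ e → fsuc≢inject₁ j (blacks-inj e)) (edge-wb (fsuc j)) (edge-bw j)

  cycle-blackWeight : ∀ j → 2 ≤ blackWeight w (blacks j)
  cycle-blackWeight j with last-or-inject₁ (suc len) j
  ... | inj₁ refl = inColumn (whites (fromℕ (suc len))) (whites fzero) (λ e → last≢0 (whites-inj e))
                      (edge-wb (fromℕ (suc len))) edge-close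
    where
    last≢0 : fromℕ (suc len) ≢ fzero
    last≢0 ()
    inColumn : ∀ i i' → i ≢ i' → Adj w i (blacks j) → Adj w i' (blacks j) → 2 ≤ blackWeight w (blacks j)
    inColumn i i' i≢i' p q = twoPositive⇒2≤sum (column w (blacks j)) i i' i≢i'
      (subst (0 <_) (sym (lookup-column w _ i)) p) (subst (0 <_) (sym (lookup-column w _ i')) q)
  ... | inj₂ (j' , refl) =
    twoPositive⇒2≤sum (column w (blacks (inject₁ j'))) (whites (inject₁ j')) (whites (fsuc j'))
      (λ e → fsuc≢inject₁ j' (sym (whites-inj e)))
      (subst (0 <_) (sym (lookup-column w _ _)) (edge-wb (inject₁ j')))
      (subst (0 <_) (sym (lookup-column w _ _)) (edge-bw j'))

notLast⇒first : ∀ m {a} (i : Fin (m + a)) → (∀ t → i ≢ m ↑ʳ t) → Σ (Fin m) λ i' → i ≡ i' ↑ˡ a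
notLast⇒first m i notLast with splitAt m i in eq
... | inj₁ i' = i' , sym (Finₚ.splitAt⁻¹-↑ˡ eq)
... | inj₂ t = ⊥-elim (notLast t (sym (Finₚ.splitAt⁻¹-↑ʳ eq)))

lookup-take : ∀ {A : Set} m {k} (xs : Vec A (m + k)) (i : Fin m) → lookup (take m xs) i ≡ lookup xs (i ↑ˡ k)
lookup-take (suc m) (x ∷ xs) fzero = refl
lookup-take (suc m) (x ∷ xs) (fsuc i) = lookup-take m xs i

entry-restrict : ∀ {m a n b} (w' : Matrix (m + a) (n + b)) i c →
  entry (restrict {m} {a} {n} {b} w') i c ≡ entry w' (i ↑ˡ a) (c ↑ˡ b)
entry-restrict {m} {a} {n} {b} w' i c = begin
    lookup (lookup (map (take n) (take m w')) i) c  ≡⟨ cong (λ z → lookup z c) (Vecₚ.lookup-map i (take n) (take m w')) ⟩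
    lookup (take n (lookup (take m w') i)) c        ≡⟨ cong (λ z → lookup (take n z) c) (lookup-take m w' i) ⟩
    lookup (take n (lookup w' (i ↑ˡ a))) c          ≡⟨ lookup-take n (lookup w' (i ↑ˡ a)) c ⟩
    lookup (lookup w' (i ↑ˡ a)) (c ↑ˡ b)            ∎
  where open ≡-Reasoning

cycle-restrict : ∀ {m a n b} (w' : Matrix (m + a) (n + b)) →
  (∀ t → whiteWeight w' (m ↑ʳ t) ≡ 1) → (∀ t → blackWeight w' (n ↑ʳ t) ≡ 1) →
  Cycle w' → Cycle (restrict {m} {a} {n} {b} w')
cycle-restrict {m} {a} {n} {b} w' whiteLeaves blackLeaves cyc = record
  { len = len
  ; whites = λ j → proj₁ (whiteFirst j)
  ; blacks = λ j → proj₁ (blackFirst j)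
  ; whites-inj = λ {j₁} {j₂} e → whites-inj (trans (proj₂ (whiteFirst j₁)) (trans (cong (_↑ˡ a) e) (sym (proj₂ (whiteFirst j₂)))))
  ; blacks-inj = λ {j₁} {j₂} e → blacks-inj (trans (proj₂ (blackFirst j₁)) (trans (cong (_↑ˡ b) e) (sym (proj₂ (blackFirst j₂)))))
  ; edge-wb = λ j → restrictEdge (edge-wb j) (proj₂ (whiteFirst j)) (proj₂ (blackFirst j))
  ; edge-bw = λ j → restrictEdge (edge-bw j) (proj₂ (whiteFirst (fsuc j))) (proj₂ (blackFirst (inject₁ j)))
  ; edge-close = restrictEdge edge-close (proj₂ (whiteFirst fzero)) (proj₂ (blackFirst (fromℕ (suc len))))
  }
  where
  open Cycle cyc
  whiteFirst : ∀ j → Σ (Fin m) λ i → whites j ≡ i ↑ˡ a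
  whiteFirst j = notLast⇒first m (whites j) λ t e →
    1+n≰n (subst (2 ≤_) (trans (cong (whiteWeight w') e) (whiteLeaves t)) (cycle-whiteWeight cyc j))
  blackFirst : ∀ j → Σ (Fin n) λ c → blacks j ≡ c ↑ˡ b
  blackFirst j = notLast⇒first n (blacks j) λ t e →
    1+n≰n (subst (2 ≤_) (trans (cong (blackWeight w') e) (blackLeaves t)) (cycle-blackWeight cyc j))
  restrictEdge : ∀ {i c i' c'} → Adj w' i c → i ≡ i' ↑ˡ a → c ≡ c' ↑ˡ b → Adj (restrict w') i' c'
  restrictEdge {i' = i'} {c'} edge refl refl = subst (0 <_) (sym (entry-restrict w' i' c')) edge

-- Weighted shapes of type (x ++ 1ᵃ, y ++ 1ᵇ) restricting to w are exactly the
-- fillings of the capacities y ++ 1ᵇ by the rows prescribed by (w, x)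
-- followed by a unit rows: the forest condition is inherited from w (the new
-- vertices are leaves) and there is no isolated vertex since all weights are
-- positive.

unitWeights⇔ : ∀ {a C} (w' : Matrix a C) →
  (∀ i → whiteWeight w' i ≡ lookup (replicate a 1) i) ⇔ AllRows (replicate a IsUnit) w'
unitWeights⇔ w' = mk⇔ (forward w') (backward w')
  where
  forward : ∀ {a C} (w' : Matrix a C) → (∀ i → whiteWeight w' i ≡ lookup (replicate a 1) i) → AllRows (replicate a IsUnit) w'
  forward [] weights = tt
  forward (v ∷ w') weights = weights fzero , forward w' (λ i → weights (fsuc i))
  backward : ∀ {a C} (w' : Matrix a C) → AllRows (replicate a IsUnit) w' → (∀ i → whiteWeight w' i ≡ lookup (replicate a 1) i)
  backward (v ∷ w') (unit , _) fzero = unit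
  backward (v ∷ w') (_ , units) (fsuc i) = backward w' units i

whiteWeights⇔ : ∀ {m a n b} (w : Matrix m n) (x : Vec ℕ m) (w' : Matrix (m + a) (n + b)) →
  ((∀ i → whiteWeight w' i ≡ lookup (x ++ replicate a 1) i) × restrict {m} {a} {n} {b} w' ≡ w)
    ⇔ AllRows (prescribedRows w x ++ replicate a IsUnit) w'
whiteWeights⇔ w x w' = mk⇔ (forward w x w') (backward w x w')
  where
  forward : ∀ {m a n b} (w : Matrix m n) (x : Vec ℕ m) (w' : Matrix (m + a) (n + b)) →
    ((∀ i → whiteWeight w' i ≡ lookup (x ++ replicate a 1) i) × restrict {m} {a} {n} {b} w' ≡ w) →
    AllRows (prescribedRows w x ++ replicate a IsUnit) w'
  forward [] [] w' (weights , _) = to (unitWeights⇔ w') weights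
  forward (wi ∷ w) (xi ∷ x) (v ∷ w') (weights , restrict≡) =
    (Vecₚ.∷-injectiveˡ restrict≡ , weights fzero) , forward w x w' ((λ i → weights (fsuc i)) , Vecₚ.∷-injectiveʳ restrict≡)
  backward : ∀ {m a n b} (w : Matrix m n) (x : Vec ℕ m) (w' : Matrix (m + a) (n + b)) →
    AllRows (prescribedRows w x ++ replicate a IsUnit) w' →
    (∀ i → whiteWeight w' i ≡ lookup (x ++ replicate a 1) i) × restrict {m} {a} {n} {b} w' ≡ w
  backward [] [] w' rows = from (unitWeights⇔ w') rows , refl
  backward (wi ∷ w) (xi ∷ x) (v ∷ w') ((take≡ , sum≡) , rows) with backward w x w' rows
  ... | weights , restrict≡ = (λ { fzero → sum≡ ; (fsuc i) → weights i }) , cong₂ _∷_ take≡ restrict≡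

blackWeight-colSums : ∀ {K C} (w : Matrix K C) j → blackWeight w j ≡ lookup (colSums w) j
blackWeight-colSums [] j = sym (Vecₚ.lookup-replicate j 0)
blackWeight-colSums (v ∷ w) j =
  trans (cong (lookup v j +_) (blackWeight-colSums w j)) (sym (Vecₚ.lookup-zipWith _+_ j v (colSums w)))

blackWeights⇔ : ∀ {K C} (w' : Matrix K C) (Y : Vec ℕ C) → (∀ j → blackWeight w' j ≡ lookup Y j) ⇔ (colSums w' ≡ Y)
blackWeights⇔ w' Y = mk⇔
  (λ weights → trans (sym (Vecₚ.tabulate∘lookup _))
                     (trans (Vecₚ.tabulate-cong (λ j → trans (sym (blackWeight-colSums w' j)) (weights j)))
                            (Vecₚ.tabulate∘lookup Y)))
  (λ { refl j → blackWeight-colSums w' j })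

positiveEntry : ∀ {C} (v : Vec ℕ C) → 1 ≤ sum v → Σ (Fin C) λ j → 0 < lookup v j
positiveEntry (zero ∷ v) |v|≥1 = let j , vj>0 = positiveEntry v |v|≥1 in fsuc j , vj>0
positiveEntry (suc x ∷ v) _ = fzero , s≤s z≤n

completion-positive : ∀ {m} a (x : Vec ℕ m) → IsComposition x → ∀ i → 1 ≤ lookup (x ++ replicate a 1) i
completion-positive a [] _ i = subst (1 ≤_) (sym (Vecₚ.lookup-replicate i 1)) ≤-refl
completion-positive a (x₀ ∷ x) composition fzero = composition fzero
completion-positive a (x₀ ∷ x) composition (fsuc i) = completion-positive a x (λ i → composition (fsuc i)) i

ShapeExtending : ∀ {m n} (x : Vec ℕ m) (y : Vec ℕ n) (a b : ℕ) (w : Matrix m n) → Matrix (m + a) (n + b) → Set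
ShapeExtending x y a b w w' = IsWeightedShapeOfType (x ++ replicate a 1) (y ++ replicate b 1) w' × restrict w' ≡ w

module _ {m n} (x : Vec ℕ m) (y : Vec ℕ n) (a b : ℕ) (x-comp : IsComposition x) (y-comp : IsComposition y)
         (w : Matrix m n) (w-forest : IsForest w) where

  shape⇔filling : ∀ w' → ShapeExtending x y a b w w' ⇔ Fill (prescribedRows w x ++ replicate a IsUnit) (y ++ replicate b 1) w'
  shape⇔filling w' = mk⇔ shape⇒filling filling⇒shape
    where
    Y : Vec ℕ (n + b)
    Y = y ++ replicate b 1
    Hs : Vec (Vec ℕ (n + b) → Set) (m + a)
    Hs = prescribedRows w x ++ replicate a IsUnit
    shape⇒filling : ShapeExtending x y a b w w' → Fill Hs Y w'
    shape⇒filling ((_ , whites , blacks) , restrict≡) =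
      from (Fill⇔ Hs Y w') (to (whiteWeights⇔ w x w') (whites , restrict≡) , to (blackWeights⇔ w' Y) blacks)
    filling⇒shape : Fill Hs Y w' → ShapeExtending x y a b w w'
    filling⇒shape filling = ((forest , noIsolated) , whites , blacks) , restrict≡
      where
      rows : AllRows Hs w'
      rows = proj₁ (to (Fill⇔ Hs Y w') filling)
      whites : ∀ i → whiteWeight w' i ≡ lookup (x ++ replicate a 1) i
      whites = proj₁ (from (whiteWeights⇔ w x w') rows)
      restrict≡ : restrict w' ≡ w
      restrict≡ = proj₂ (from (whiteWeights⇔ w x w') rows)
      blacks : ∀ j → blackWeight w' j ≡ lookup Y j
      blacks = from (blackWeights⇔ w' Y) (proj₂ (to (Fill⇔ Hs Y w') filling))
      whiteLeaves : ∀ t → whiteWeight w' (m ↑ʳ t) ≡ 1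
      whiteLeaves t = trans (whites (m ↑ʳ t)) (trans (Vecₚ.lookup-++ʳ x (replicate a 1) t) (Vecₚ.lookup-replicate t 1))
      blackLeaves : ∀ t → blackWeight w' (n ↑ʳ t) ≡ 1
      blackLeaves t = trans (blacks (n ↑ʳ t)) (trans (Vecₚ.lookup-++ʳ y (replicate b 1) t) (Vecₚ.lookup-replicate t 1))
      forest : IsForest w'
      forest cyc = w-forest (subst Cycle restrict≡ (cycle-restrict w' whiteLeaves blackLeaves cyc))
      noIsolated : NoIsolated w'
      noIsolated =
        (λ i → positiveEntry (lookup w' i) (subst (1 ≤_) (sym (whites i)) (completion-positive a x x-comp i))) ,
        (λ j → let i , positive = positiveEntry (column w' j) (subst (1 ≤_) (sym (blacks j)) (completion-positive b y y-comp j))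
               in i , subst (0 <_) (lookup-column w' j i) positive)

-- Falling factorials of the given weights.  Writing xᵢ! = (xᵢ)_{uᵢ} · (xᵢ - uᵢ)!
-- relates the theorem's products to the factorials of the residual weights.

fallingProduct : ∀ {k} → Vec ℕ k → (Fin k → ℕ) → ℕ
fallingProduct x u = prodV (tabulate (λ i → falling (lookup x i) (u i)))

prod!-falling : ∀ {k} (x u : Vec ℕ k) → u ≤v x → prod! x ≡ fallingProduct x (lookup u) * prod! (x ∸v u)
prod!-falling [] [] [] = refl
prod!-falling (x₀ ∷ x) (u₀ ∷ u) (u₀≤x₀ ∷ u≤x) = begin
    x₀ ! * prod! x                                                   ≡⟨ cong₂ _*_ (falling-factorial x₀ u₀ u₀≤x₀) (prod!-falling x u u≤x) ⟩
    falling x₀ u₀ * (x₀ ∸ u₀) ! * (Fx * prod! (x ∸v u))              ≡⟨ solve 4 (λ f g t p → f :* g :* (t :* p) := f :* t :* (g :* p)) refl (falling x₀ u₀) ((x₀ ∸ u₀) !) Fx (prod! (x ∸v u)) ⟩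
    falling x₀ u₀ * Fx * ((x₀ ∸ u₀) ! * prod! (x ∸v u))              ∎
  where
  open ≡-Reasoning
  open +-*-Solver
  Fx : ℕ
  Fx = fallingProduct x (lookup u)

fallingProduct-≰ : ∀ {k} (x u : Vec ℕ k) → ¬ u ≤v x → fallingProduct x (lookup u) ≡ 0
fallingProduct-≰ [] [] u≰x = ⊥-elim (u≰x [])
fallingProduct-≰ (x₀ ∷ x) (u₀ ∷ u) u≰x with u₀ ≤? x₀
... | yes u₀≤x₀ = trans (cong (falling x₀ u₀ *_) (fallingProduct-≰ x u (λ u≤x → u≰x (u₀≤x₀ ∷ u≤x)))) (*-zeroʳ (falling x₀ u₀))
... | no u₀≰x₀ = cong (_* _) (falling-> x₀ u₀ (≰⇒> u₀≰x₀))

fallingProduct-whiteWeight : ∀ {m n} (x : Vec ℕ m) (w : Matrix m n) →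
  fallingProduct x (whiteWeight w) ≡ fallingProduct x (lookup (rowSums w))
fallingProduct-whiteWeight x w = cong prodV (Vecₚ.tabulate-cong (λ i → cong (falling (lookup x i)) (sym (Vecₚ.lookup-map i sum w))))

fallingProduct-blackWeight : ∀ {m n} (y : Vec ℕ n) (w : Matrix m n) →
  fallingProduct y (blackWeight w) ≡ fallingProduct y (lookup (colSums w))
fallingProduct-blackWeight y w = cong prodV (Vecₚ.tabulate-cong (λ j → cong (falling (lookup y j)) (blackWeight-colSums w j)))

+v-mono : ∀ {C} (u₁ u₂ v₁ v₂ : Vec ℕ C) → u₁ ≤v u₂ → v₁ ≤v v₂ → (u₁ +v v₁) ≤v (u₂ +v v₂)
+v-mono [] [] [] [] [] [] = []
+v-mono (_ ∷ u₁) (_ ∷ u₂) (_ ∷ v₁) (_ ∷ v₂) (p ∷ ps) (q ∷ qs) = +-mono-≤ p q ∷ +v-mono u₁ u₂ v₁ v₂ ps qs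

prescribedRows⇒rowSums≤ : ∀ {m a n b} (w : Matrix m n) (x : Vec ℕ m) (Hs : Vec (Vec ℕ (n + b) → Set) a)
  (w' : Matrix (m + a) (n + b)) → AllRows (prescribedRows w x ++ Hs) w' → rowSums w ≤v x
prescribedRows⇒rowSums≤ [] [] Hs w' _ = []
prescribedRows⇒rowSums≤ {n = n} (wi ∷ w) (xi ∷ x) Hs (v ∷ w') ((take≡ , sum≡) , rows) =
  subst (_≤ xi) (cong sum take≡) (subst (sum (take n v) ≤_) (trans (sym (sum-take+drop n v)) sum≡) (m≤m+n _ _)) ∷
  prescribedRows⇒rowSums≤ w x Hs w' rows

restrict⇒colSums≤ : ∀ {m a n b} (w : Matrix m n) (w' : Matrix (m + a) (n + b)) →
  restrict {m} {a} {n} {b} w' ≡ w → colSums w ≤v take n (colSums w')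
restrict⇒colSums≤ [] w' _ = zeros≤v _
restrict⇒colSums≤ {n = n} (wi ∷ w) (v ∷ w') restrict≡ =
  subst ((wi +v colSums w) ≤v_) (sym (Vecₚ.take-zipWith _+_ v (colSums w')))
    (+v-mono wi (take n v) (colSums w) (take n (colSums w'))
      (subst (_≤v take n v) (Vecₚ.∷-injectiveˡ restrict≡) (Pointwise.refl ≤-refl))
      (restrict⇒colSums≤ w w' (Vecₚ.∷-injectiveʳ restrict≡)))

shape⇒rowSums≤ : ∀ {m n} (x : Vec ℕ m) (y : Vec ℕ n) a b (w : Matrix m n) w' →
  ShapeExtending x y a b w w' → rowSums w ≤v x
shape⇒rowSums≤ x y a b w w' ((_ , whites , _) , restrict≡) =
  prescribedRows⇒rowSums≤ w x _ w' (to (whiteWeights⇔ w x w') (whites , restrict≡))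

shape⇒colSums≤ : ∀ {m n} (x : Vec ℕ m) (y : Vec ℕ n) a b (w : Matrix m n) w' →
  ShapeExtending x y a b w w' → colSums w ≤v y
shape⇒colSums≤ {n = n} x y a b w w' ((_ , _ , blacks) , restrict≡) =
  subst (colSums w ≤v_) (trans (cong (take n) (to (blackWeights⇔ w' _) blacks)) (take-++ y (replicate b 1)))
    (restrict⇒colSums≤ w w' restrict≡)

-- Degree balance.  With R = |x| - L and S = |y| - L the residual weights
-- (L the total weight of w), a = d - |x| and b = d - |y|:

sum-ones : ∀ b → sum (replicate b 1) ≡ b
sum-ones zero = refl
sum-ones (suc b) = cong suc (sum-ones b)

-- the theorem's condition |x| + |y| ≤ d + L says that the b black leaves
-- can absorb the white residual weight R, and d + L - |x| - |y| = b - R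
whiteBalance : ∀ R L sx sy b d → R + L ≡ sx → b + sy ≡ d →
  (sx + sy ≤ d + L ⇔ R ≤ b) × (d + L ∸ (sx + sy) ≡ b ∸ R)
whiteBalance R L .(R + L) sy b .(b + sy) refl refl =
  mk⇔ (λ le → +-cancelʳ-≤ (L + sy) R b (subst₂ _≤_ reassocʳ reassocᵇ le))
      (λ R≤b → subst₂ _≤_ (sym reassocʳ) (sym reassocᵇ) (+-monoˡ-≤ (L + sy) R≤b)) ,
  trans (cong₂ _∸_ (trans reassocᵇ (+-comm b _)) (trans reassocʳ (+-comm R _))) ([m+n]∸[m+o]≡n∸o (L + sy) b R)
  where
  open +-*-Solver
  reassocʳ : R + L + sy ≡ R + (L + sy)
  reassocʳ = +-assoc R L sy
  reassocᵇ : b + sy + L ≡ b + (L + sy)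
  reassocᵇ = solve 3 (λ b s L → b :+ s :+ L := b :+ (L :+ s)) refl b sy L

-- and then the remaining capacity S + (b - R) is exactly the number a of white leaves
leafBalance : ∀ R S L sx sy a b d → R + L ≡ sx → S + L ≡ sy → a + sx ≡ d → b + sy ≡ d → R ≤ b →
  S + (b ∸ R) ≡ a
leafBalance R S L sx sy a b d eX eY eA eB R≤b = +-cancelʳ-≡ sx _ _ (begin
    S + (b ∸ R) + sx          ≡⟨ cong (S + (b ∸ R) +_) eX ⟨
    S + (b ∸ R) + (R + L)     ≡⟨ solve 4 (λ S B R L → S :+ B :+ (R :+ L) := (S :+ L) :+ (B :+ R)) refl S (b ∸ R) R L ⟩
    (S + L) + (b ∸ R + R)     ≡⟨ cong₂ _+_ eY (m∸n+n≡m R≤b) ⟩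
    sy + b                    ≡⟨ trans (+-comm sy b) eB ⟩
    d                         ≡⟨ eA ⟨
    a + sx                    ∎)
  where
  open ≡-Reasoning
  open +-*-Solver

residualCount : ∀ {m n} (x : Vec ℕ m) (y : Vec ℕ n) (d : ℕ) →
  IsComposition x → IsComposition y → sum x ≤ d → sum y ≤ d →
  (w : Matrix m n) → IsForest w → rowSums w ≤v x → colSums w ≤v y →
  Σ ℕ λ c → HasCount (ShapeExtending x y (d ∸ sum x) (d ∸ sum y) w) c
    × (sum (residual w x) ≤ d ∸ sum y →
         c * denominator (residual w x) (y ∸v colSums w) (d ∸ sum y) ≡ (d ∸ sum x) ! * (d ∸ sum y) !)
    × (¬ sum (residual w x) ≤ d ∸ sum y → c ≡ 0)
residualCount x y d x-comp y-comp x≤d y≤d w w-forest rows≤ cols≤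
  with completionCount (d ∸ sum x) w x y (replicate (d ∸ sum y) 1) (replicate-ZeroOne _ ≤-refl) rows≤
... | c , fillings , formula , vanish =
  c , HasCount-⇔ (λ w' → mk⇔ (from (shape⇔filling′ w')) (to (shape⇔filling′ w'))) fillings ,
  residualFormula , (λ R≰b → vanish (λ feasible → R≰b (subst (R ≤_) (sum-ones b) (proj₂ feasible))))
  where
  a : ℕ
  a = d ∸ sum x
  b : ℕ
  b = d ∸ sum y
  L : ℕ
  L = totalWeight w
  R : ℕ
  R = sum (residual w x)
  S : ℕ
  S = sum (y ∸v colSums w)
  shape⇔filling′ : ∀ w' → ShapeExtending x y a b w w' ⇔ Fill (prescribedRows w x ++ replicate a IsUnit) (y ++ replicate b 1) w'
  shape⇔filling′ = shape⇔filling x y a b x-comp y-comp w w-forest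
  R+L≡|x| : R + L ≡ sum x
  R+L≡|x| = sum-∸v+ x (rowSums w) rows≤
  S+L≡|y| : S + L ≡ sum y
  S+L≡|y| = trans (cong (S +_) (sym (sum-colSums w))) (sum-∸v+ y (colSums w) cols≤)
  residualFormula : R ≤ b → c * denominator (residual w x) (y ∸v colSums w) b ≡ a ! * b !
  residualFormula R≤b = begin
      c * denominator (residual w x) (y ∸v colSums w) b                  ≡⟨ cong (λ l → c * denominator (residual w x) (y ∸v colSums w) l) (sum-ones b) ⟨
      c * denominator (residual w x) (y ∸v colSums w) (sum (replicate b 1)) ≡⟨ formula (cols≤ , subst (R ≤_) (sym (sum-ones b)) R≤b) ⟩
      a ! * (sum (replicate b 1)) ! * δ (S + (sum (replicate b 1) ∸ R)) a ≡⟨ cong (λ l → a ! * l ! * δ (S + (l ∸ R)) a) (sum-ones b) ⟩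
      a ! * b ! * δ (S + (b ∸ R)) a                                     ≡⟨ cong (λ s → a ! * b ! * δ s a) (leafBalance R S L (sum x) (sum y) a b d R+L≡|x| S+L≡|y| (m∸n+n≡m x≤d) (m∸n+n≡m y≤d) R≤b) ⟩
      a ! * b ! * δ a a                                                 ≡⟨ cong (a ! * b ! *_) (δ-refl a) ⟩
      a ! * b ! * 1                                                     ≡⟨ *-identityʳ _ ⟩
      a ! * b !                                                         ∎
    where open ≡-Reasoning

module _ {m n} (x : Vec ℕ m) (y : Vec ℕ n) (d : ℕ) (w : Matrix m n) where

  theoremRHS : ℕ
  theoremRHS = ((d ∸ sum y) ! * fallingProduct x (whiteWeight w)) * ((d ∸ sum x) ! * fallingProduct y (blackWeight w))

  CountFormula : ℕ → Set
  CountFormula c =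
    (sum x + sum y ≤ d + totalWeight w →
       c * (prod! x * prod! y) * ((d + totalWeight w ∸ (sum x + sum y)) !) ≡ theoremRHS)
    × (¬ (sum x + sum y ≤ d + totalWeight w) → c ≡ 0)
    × (sum x ⊓ sum y < totalWeight w → c ≡ 0)
    × (d + totalWeight w < sum x + sum y → c ≡ 0)

  theoremRHS-rows≰ : ¬ rowSums w ≤v x → theoremRHS ≡ 0
  theoremRHS-rows≰ rows≰ = begin
      B * FX * AFY    ≡⟨ cong (λ F → B * F * AFY) (trans (fallingProduct-whiteWeight x w) (fallingProduct-≰ x (rowSums w) rows≰)) ⟩
      B * 0 * AFY     ≡⟨ cong (_* AFY) (*-zeroʳ B) ⟩
      0               ∎
    where
    open ≡-Reasoning
    B : ℕ
    B = (d ∸ sum y) !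
    FX : ℕ
    FX = fallingProduct x (whiteWeight w)
    AFY : ℕ
    AFY = (d ∸ sum x) ! * fallingProduct y (blackWeight w)

  theoremRHS-cols≰ : ¬ colSums w ≤v y → theoremRHS ≡ 0
  theoremRHS-cols≰ cols≰ = begin
      BFX * (A * FY)  ≡⟨ cong (λ F → BFX * (A * F)) (trans (fallingProduct-blackWeight y w) (fallingProduct-≰ y (colSums w) cols≰)) ⟩
      BFX * (A * 0)   ≡⟨ cong (BFX *_) (*-zeroʳ A) ⟩
      BFX * 0         ≡⟨ *-zeroʳ BFX ⟩
      0               ∎
    where
    open ≡-Reasoning
    BFX : ℕ
    BFX = (d ∸ sum y) ! * fallingProduct x (whiteWeight w)
    A : ℕ
    A = (d ∸ sum x) !
    FY : ℕ
    FY = fallingProduct y (blackWeight w)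

  zero-CountFormula : theoremRHS ≡ 0 → CountFormula 0
  zero-CountFormula rhs≡0 = (λ _ → sym rhs≡0) , (λ _ → refl) , (λ _ → refl) , (λ _ → refl)

feasible-CountFormula : ∀ {m n} (x : Vec ℕ m) (y : Vec ℕ n) (d : ℕ) → sum y ≤ d →
  (w : Matrix m n) → rowSums w ≤v x → colSums w ≤v y → (c : ℕ) →
  (sum (residual w x) ≤ d ∸ sum y →
     c * denominator (residual w x) (y ∸v colSums w) (d ∸ sum y) ≡ (d ∸ sum x) ! * (d ∸ sum y) !) →
  (¬ sum (residual w x) ≤ d ∸ sum y → c ≡ 0) →
  CountFormula x y d w c
feasible-CountFormula x y d y≤d w rows≤ cols≤ c residualFormula residualVanish =
  formula , vanish , (λ min<L → ⊥-elim (<⇒≱ min<L (⊓-glb L≤|x| L≤|y|))) , (λ lt → vanish (<⇒≱ lt))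
  where
  a : ℕ
  a = d ∸ sum x
  b : ℕ
  b = d ∸ sum y
  L : ℕ
  L = totalWeight w
  R : ℕ
  R = sum (residual w x)
  S : ℕ
  S = sum (y ∸v colSums w)
  R+L≡|x| : R + L ≡ sum x
  R+L≡|x| = sum-∸v+ x (rowSums w) rows≤
  S+L≡|y| : S + L ≡ sum y
  S+L≡|y| = trans (cong (S +_) (sym (sum-colSums w))) (sum-∸v+ y (colSums w) cols≤)
  L≤|x| : L ≤ sum x
  L≤|x| = subst (L ≤_) R+L≡|x| (m≤n+m L R)
  L≤|y| : L ≤ sum y
  L≤|y| = subst (L ≤_) S+L≡|y| (m≤n+m L S)
  balance : (sum x + sum y ≤ d + L ⇔ R ≤ b) × (d + L ∸ (sum x + sum y) ≡ b ∸ R)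
  balance = whiteBalance R L (sum x) (sum y) b d R+L≡|x| (m∸n+n≡m y≤d)
  FX : ℕ
  FX = fallingProduct x (whiteWeight w)
  FY : ℕ
  FY = fallingProduct y (blackWeight w)
  prod!x : prod! x ≡ FX * prod! (residual w x)
  prod!x = trans (prod!-falling x (rowSums w) rows≤) (cong (_* prod! (residual w x)) (sym (fallingProduct-whiteWeight x w)))
  prod!y : prod! y ≡ FY * prod! (y ∸v colSums w)
  prod!y = trans (prod!-falling y (colSums w) cols≤) (cong (_* prod! (y ∸v colSums w)) (sym (fallingProduct-blackWeight y w)))
  formula : sum x + sum y ≤ d + L → c * (prod! x * prod! y) * ((d + L ∸ (sum x + sum y)) !) ≡ theoremRHS x y d w
  formula le = begin
      c * (prod! x * prod! y) * ((d + L ∸ (sum x + sum y)) !)  ≡⟨ cong₂ (λ p e → c * p * e !) (cong₂ _*_ prod!x prod!y) (proj₂ balance) ⟩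
      c * (FX * Pr * (FY * Ps)) * (b ∸ R) !                   ≡⟨ solve 6 (λ c FX Pr FY Ps F → c :* (FX :* Pr :* (FY :* Ps)) :* F := FX :* FY :* (c :* (Pr :* Ps :* F))) refl c FX Pr FY Ps ((b ∸ R) !) ⟩
      FX * FY * (c * (Pr * Ps * (b ∸ R) !))                   ≡⟨ cong (FX * FY *_) (residualFormula (to (proj₁ balance) le)) ⟩
      FX * FY * (a ! * b !)                                   ≡⟨ solve 4 (λ FX FY A B → FX :* FY :* (A :* B) := B :* FX :* (A :* FY)) refl FX FY (a !) (b !) ⟩
      (b ! * FX) * (a ! * FY)                                 ∎
    where
    open ≡-Reasoning
    open +-*-Solver
    Pr : ℕ
    Pr = prod! (residual w x)
    Ps : ℕ
    Ps = prod! (y ∸v colSums w)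
  vanish : ¬ (sum x + sum y ≤ d + L) → c ≡ 0
  vanish nle = residualVanish (λ R≤b → nle (from (proj₁ balance) R≤b))

lemma2 : ∀ {m n} (x : Vec ℕ m) (y : Vec ℕ n) (d : ℕ) →
    IsComposition x → IsComposition y → sum x ≤ d → sum y ≤ d →
    (w : Matrix m n) → IsDegenerateWeightedShape w →
    Σ ℕ λ c →
      HasCount (λ (w' : Matrix (m + (d ∸ sum x)) (n + (d ∸ sum y))) →
                  IsWeightedShapeOfType (complete x d) (complete y d) w' × restrict w' ≡ w) c
      × (sum x + sum y ≤ d + totalWeight w →
           c * (prodV (map (λ a → a !) x) * prodV (map (λ a → a !) y)) * ((d + totalWeight w ∸ (sum x + sum y)) !)
             ≡ ((d ∸ sum y) ! * prodV (tabulate (λ i → falling (lookup x i) (whiteWeight w i))))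
               * ((d ∸ sum x) ! * prodV (tabulate (λ j → falling (lookup y j) (blackWeight w j)))))
      × (¬ (sum x + sum y ≤ d + totalWeight w) → c ≡ 0)
      × (sum x ⊓ sum y < totalWeight w → c ≡ 0)
      × (d + totalWeight w < sum x + sum y → c ≡ 0)
lemma2 x y d x-comp y-comp x≤d y≤d w w-forest with rowSums w ≤v? x | colSums w ≤v? y
... | yes rows≤ | yes cols≤ =
  let c , count , residualFormula , residualVanish = residualCount x y d x-comp y-comp x≤d y≤d w w-forest rows≤ cols≤
  in c , count , feasible-CountFormula x y d y≤d w rows≤ cols≤ c residualFormula residualVanish
... | no rows≰ | _ =
  0 , HasCount-empty (λ w' shape → rows≰ (shape⇒rowSums≤ x y _ _ w w' shape)) ,
  zero-CountFormula x y d w (theoremRHS-rows≰ x y d w rows≰)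
... | yes _ | no cols≰ =
  0 , HasCount-empty (λ w' shape → cols≰ (shape⇒colSums≤ x y _ _ w w' shape)) ,
  zero-CountFormula x y d w (theoremRHS-cols≰ x y d w cols≰)
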